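{- Let $d \geq 2$ and let $P \subseteq \mathbb{R}^d$ be a $d$-dimensional lattice polytope with $P = -P$, such that the only point of $\mathbb{Z}^d$ in the interior of $P$ is the origin and $|P \cap \mathbb{Z}^d| = 3^d$. Write $P_{\mathbb{Z}} = P \cap \mathbb{Z}^d$. Let $F$ be a facet of $P$ with $F_{\mathbb{Z}} = F \cap \mathbb{Z}^d$, let $u_F \in (\mathbb{Q}^d)^*$ be the unique linear functional with $u_F(F) = 1$ and $u_F(P) \leq 1$, let $u_F^\perp = \{v \in \mathbb{R}^d : u_F(v) = 0\}$, and let $x \in \mathbb{Z}^d$ lie in the relative interior of $F$. Then $P_{\mathbb{Z}}$ is the disjoint union $F_{\mathbb{Z}} \sqcup (P_{\mathbb{Z}} \cap u_F^\perp) \sqcup (-F_{\mathbb{Z}})$. Moreover, the map $\mathbb{Z}^d \to \mathbb{Z}^d$, $y \mapsto x + y$, induces bijections $-F_{\mathbb{Z}} \to P_{\mathbb{Z}} \cap u_F^\perp$ and $P_{\mathbb{Z}} \cap u_F^\perp \to F_{\mathbb{Z}}$. In particular, every vertex of $P$ lies in $F_{\mathbb{Z}} \sqcup (-F_{\mathbb{Z}})$.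
   Context: A lattice polytope is the convex hull of finitely many points of $\mathbb{Z}^d$. A facet is a face of dimension $d-1$. -}

module Defs where

open import Data.Nat as ℕ using (ℕ; zero; suc)
open import Data.Integer as ℤ using (ℤ)
open import Data.Rational as ℚ using (ℚ; 0ℚ; 1ℚ)
open import Data.Fin using (Fin; zero; suc)
open import Data.Vec using (Vec; []; _∷_; map; zipWith; foldr; replicate)
open import Data.Vec.Relation.Unary.All using (All)
open import Data.Product using (Σ; ∃; _×_; _,_)
open import Data.Sum using (_⊎_)
open import Relation.Binary.PropositionalEquality using (_≡_; _≢_)
open import Relation.Nullary using (¬_)

Pt : ℕ → Set
Pt d = Vec ℚ d

ZPt : ℕ → Set
ZPt d = Vec ℤ d

emb : ∀ {d} → ZPt d → Pt d
emb = map (λ z → z ℚ./ 1)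

infixl 6 _+v_ _-v_
_+v_ : ∀ {d} → Pt d → Pt d → Pt d
_+v_ = zipWith ℚ._+_

_-v_ : ∀ {d} → Pt d → Pt d → Pt d
_-v_ = zipWith ℚ._-_

negv : ∀ {d} → Pt d → Pt d
negv = map (λ q → ℚ.- q)

_*s_ : ∀ {d} → ℚ → Pt d → Pt d
q *s v = map (q ℚ.*_) v

0v : ∀ {d} → Pt d
0v = replicate _ 0ℚ

-- standard pairing of a linear functional (given by its coefficients) with a point
_·_ : ∀ {d} → Pt d → Pt d → ℚ
u · p = foldr _ ℚ._+_ 0ℚ (zipWith ℚ._*_ u p)

_+z_ : ∀ {d} → ZPt d → ZPt d → ZPt d
_+z_ = zipWith ℤ._+_

negz : ∀ {d} → ZPt d → ZPt d
negz = map (λ z → ℤ.- z)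

0z : ∀ {d} → ZPt d
0z = replicate _ (ℤ.+ 0)

sumℚ : ∀ {k} → (Fin k → ℚ) → ℚ
sumℚ {zero} f = 0ℚ
sumℚ {suc k} f = f zero ℚ.+ sumℚ (λ i → f (suc i))

sumv : ∀ {d k} → (Fin k → Pt d) → Pt d
sumv {k = zero} f = 0v
sumv {k = suc k} f = f zero +v sumv (λ i → f (suc i))

PtSet : ℕ → Set₁
PtSet d = Pt d → Set

-- The lattice polytope conv(V) for V : Fin m → ℤ^d, restricted to rational points.
-- (Since V is rational, a rational point lies in the real convex hull iff it is a
-- rational convex combination of V.)
Conv : ∀ {d m} → (Fin m → ZPt d) → PtSet d
Conv {m = m} V p =
  Σ (Fin m → ℚ) λ w →
    (∀ i → 0ℚ ℚ.≤ w i) × (sumℚ w ≡ 1ℚ) × (sumv (λ i → w i *s emb (V i)) ≡ p)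

InAff : ∀ {d} → PtSet d → PtSet d
InAff {d} S p =
  Σ ℕ λ k → Σ (Fin k → Pt d) λ q → Σ (Fin k → ℚ) λ w →
    (∀ i → S (q i)) × (sumℚ w ≡ 1ℚ) × (sumv (λ i → w i *s q i) ≡ p)

AffIndep : ∀ {d k} → (Fin (suc k) → Pt d) → Set
AffIndep {k = k} p =
  (l : Fin k → ℚ) → sumv (λ i → l i *s (p (suc i) -v p zero)) ≡ 0v → ∀ i → l i ≡ 0ℚ

DimAtLeast : ∀ {d} → PtSet d → ℕ → Set
DimAtLeast {d} S k =
  Σ (Fin (suc k) → Pt d) λ p → (∀ i → S (p i)) × AffIndep p

HasDim : ∀ {d} → PtSet d → ℕ → Set
HasDim S k = DimAtLeast S k × ¬ DimAtLeast S (suc k)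

Small : ∀ {d} → ℚ → Pt d → Set
Small ε v = All (λ q → ℚ.∣ q ∣ ℚ.≤ ε) v

Interior : ∀ {d} → PtSet d → PtSet d
Interior S p = Σ ℚ λ ε → (0ℚ ℚ.< ε) × (∀ v → Small ε v → S (p +v v))

RelInterior : ∀ {d} → PtSet d → PtSet d
RelInterior S p =
  S p × Σ ℚ λ ε → (0ℚ ℚ.< ε) × (∀ v → Small ε v → InAff S (p +v v) → S (p +v v))

Face : ∀ {d} → PtSet d → Pt d → ℚ → PtSet d
Face P a c p = P p × (a · p ≡ c)

IsFacet : ∀ {d} → PtSet d → Pt d → ℚ → Set
IsFacet {d} P a c = (∀ p → P p → a · p ℚ.≤ c) × HasDim (Face P a c) (ℕ.pred d)

IsVertex : ∀ {d} → PtSet d → Pt d → Set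
IsVertex P p =
  P p × (∀ q r t → P q → P r → 0ℚ ℚ.< t → t ℚ.< 1ℚ →
           p ≡ (t *s q) +v ((1ℚ ℚ.- t) *s r) → q ≡ r)

-- For q ∈ P with u · q < 1, every point strictly
-- between x and q is interior to P: a small perturbation is absorbed by shifting weight between x and q
-- (which adjusts u) and by moving x inside F (which keeps u = 1). Hence if two lattice points p, p′ of P
-- are congruent mod 3, then (p - p′)/3 is an interior lattice point, so p = p′; since |P ∩ ℤ^d| = 3^d,
-- P ∩ ℤ^d meets every residue class mod 3. For z ∈ P ∩ ℤ^d with u · z < 1, x + z is congruent to some
-- p ∈ P ∩ ℤ^d and (x + z - p)/3 lies strictly between x and the midpoint of z and -p, so x + z = p ∈ P.
-- Applied to z and -z this leaves only u · z ∈ {1, 0, -1} and gives the two bijections; lattice points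
-- with u = 1 lie in F because x is relatively interior. A vertex z with u · z = 0 would be the midpoint
-- of x + z and z - x.

module Submission where

open import Defs
open import Data.Nat as ℕ using (ℕ; zero; suc; _^_; s≤s)
open import Data.Nat.Properties as ℕP using ()
open import Data.Nat.Coprimality as Coprimality using ()
open import Data.Integer as ℤ using (ℤ; -[1+_])
open import Data.Integer.Properties as ℤP using ()
open import Data.Integer.DivMod as ℤD using (_%ℕ_; _/ℕ_)
open import Data.Integer.Tactic.RingSolver using (solve-∀)
open import Data.Rational as ℚ using (ℚ; 0ℚ; 1ℚ; ½; mkℚ; _≤_; _<_; ∣_∣; _+_; _*_; _-_; -_; 1/_; _⊓_)
open import Data.Rational.Properties as ℚP using ()
open import Data.Rational.Solver using (module +-*-Solver)
open import Data.Fin as Fin using (Fin; zero; suc; combine; remQuot; fromℕ<; toℕ; punchOut)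
open import Data.Fin.Properties as FinP using ()
open import Data.Vec using (Vec; []; _∷_; _++_; splitAt; head; tail; map; replicate; tabulate; lookup)
open import Data.Vec.Relation.Unary.All as All using (All; []; _∷_)
open import Data.Vec.Relation.Unary.All.Properties using (++⁺; lookup⁻)
open import Data.List as List using (List; length; _∷_)
open import Data.List.Relation.Unary.All as ListAll using ()
open import Data.List.Relation.Unary.AllPairs using (_∷_)
open import Data.List.Relation.Unary.Unique.Propositional using (Unique)
open import Data.List.Membership.Propositional using (_∈_)
open import Data.List.Membership.Propositional.Properties using (∈-lookup)
open import Data.Product using (Σ; _×_; _,_; proj₁; proj₂)
open import Data.Sum using (_⊎_; inj₁; inj₂)
open import Data.Empty using (⊥-elim)
open import Function using (_∘_)
open import Function.Definitions using (Injective)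
open import Relation.Binary.Definitions using (tri<; tri≈; tri>)
open import Relation.Binary.PropositionalEquality
open import Relation.Nullary using (¬_; Dec; yes; no)
open import Relation.Nullary.Decidable using (toWitness)
open +-*-Solver

p≤q⇒0≤q-p : ∀ {p q} → p ≤ q → 0ℚ ≤ q - p
p≤q⇒0≤q-p {p} {q} h = subst (_≤ q - p) (ℚP.+-inverseʳ p) (ℚP.+-monoˡ-≤ (- p) h)

0≤q-p⇒p≤q : ∀ {p q} → 0ℚ ≤ q - p → p ≤ q
0≤q-p⇒p≤q {p} {q} h =
  subst₂ _≤_ (ℚP.+-identityʳ p) (solve 2 (λ p q → p :+ (q :- p) := q) refl p q) (ℚP.+-monoʳ-≤ p h)

p<q⇒0<q-p : ∀ {p q} → p < q → 0ℚ < q - p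
p<q⇒0<q-p {p} {q} h = subst (_< q - p) (ℚP.+-inverseʳ p) (ℚP.+-monoˡ-< (- p) h)

0<q-p⇒p<q : ∀ {p q} → 0ℚ < q - p → p < q
0<q-p⇒p<q {p} {q} h =
  subst₂ _<_ (ℚP.+-identityʳ p) (solve 2 (λ p q → p :+ (q :- p) := q) refl p q) (ℚP.+-monoʳ-< p h)

≤∧≢⇒< : ∀ {p q} → p ≤ q → p ≢ q → p < q
≤∧≢⇒< {p} {q} p≤q p≢q with ℚP.<-cmp p q
... | tri< p<q _ _ = p<q
... | tri≈ _ p≡q _ = ⊥-elim (p≢q p≡q)
... | tri> _ _ p>q = ⊥-elim (ℚP.<-irrefl refl (ℚP.<-≤-trans p>q p≤q))

*-nonneg : ∀ {p q} → 0ℚ ≤ p → 0ℚ ≤ q → 0ℚ ≤ p * q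
*-nonneg {p} {q} p≥0 q≥0 =
  ℚP.nonNegative⁻¹ _ {{ℚP.nonNeg*nonNeg⇒nonNeg p {{ℚ.nonNegative p≥0}} q {{ℚ.nonNegative q≥0}}}}

*-pos : ∀ {p q} → 0ℚ < p → 0ℚ < q → 0ℚ < p * q
*-pos {p} {q} p>0 q>0 = ℚP.positive⁻¹ _ {{ℚP.pos*pos⇒pos p {{ℚ.positive p>0}} q {{ℚ.positive q>0}}}}

+-nonneg : ∀ {p q} → 0ℚ ≤ p → 0ℚ ≤ q → 0ℚ ≤ p + q
+-nonneg {p} {q} p≥0 q≥0 = subst (_≤ p + q) (ℚP.+-identityʳ 0ℚ) (ℚP.+-mono-≤ p≥0 q≥0)

+-pos : ∀ {p q} → 0ℚ < p → 0ℚ ≤ q → 0ℚ < p + q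
+-pos {p} {q} p>0 q≥0 = subst (_< p + q) (ℚP.+-identityʳ 0ℚ) (ℚP.+-mono-<-≤ p>0 q≥0)

1/-pos : ∀ {p} (p>0 : 0ℚ < p) → 0ℚ < (1/ p) {{ℚ.>-nonZero p>0}}
1/-pos {p} p>0 = ℚP.positive⁻¹ _ {{ℚP.1/pos⇒pos p {{ℚ.positive p>0}}}}

⊓-pos : ∀ {p q} → 0ℚ < p → 0ℚ < q → 0ℚ < p ⊓ q
⊓-pos {p} {q} p>0 q>0 with ℚP.⊓-sel p q
... | inj₁ p⊓q≡p = subst (0ℚ <_) (sym p⊓q≡p) p>0
... | inj₂ p⊓q≡q = subst (0ℚ <_) (sym p⊓q≡q) q>0

*-monoʳ-≤-nonneg : ∀ {p q r} → p ≤ q → 0ℚ ≤ r → p * r ≤ q * r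
*-monoʳ-≤-nonneg {r = r} p≤q r≥0 = ℚP.*-monoʳ-≤-nonNeg r {{ℚ.nonNegative r≥0}} p≤q

p≤∣p∣ : ∀ p → p ≤ ∣ p ∣
p≤∣p∣ p with ℚP.∣p∣≡p∨∣p∣≡-p p
... | inj₁ ∣p∣≡p = ℚP.≤-reflexive (sym ∣p∣≡p)
... | inj₂ ∣p∣≡-p = 0≤q-p⇒p≤q (subst (λ r → 0ℚ ≤ ∣ p ∣ + r) ∣p∣≡-p (+-nonneg (ℚP.0≤∣p∣ p) (ℚP.0≤∣p∣ p)))

∣p∣≤q⇒p≤q : ∀ {p q} → ∣ p ∣ ≤ q → p ≤ q
∣p∣≤q⇒p≤q {p} = ℚP.≤-trans (p≤∣p∣ p)

∣p∣≤q⇒-q≤p : ∀ {p q} → ∣ p ∣ ≤ q → - q ≤ p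
∣p∣≤q⇒-q≤p {p} {q} ∣p∣≤q = subst (- q ≤_) (solve 1 (λ p → :- (:- p) := p) refl p)
  (ℚP.neg-antimono-≤ (ℚP.≤-trans (p≤∣p∣ (- p)) (subst (_≤ q) (sym (ℚP.∣-p∣≡∣p∣ p)) ∣p∣≤q)))

Pt0-trivial : (v : Pt 0) → v ≡ 0v
Pt0-trivial [] = refl

+v-identityˡ : ∀ {d} (X : Pt d) → 0v +v X ≡ X
+v-identityˡ [] = refl
+v-identityˡ (x ∷ X) = cong₂ _∷_ (ℚP.+-identityˡ x) (+v-identityˡ X)

+v-identityʳ : ∀ {d} (X : Pt d) → X +v 0v ≡ X
+v-identityʳ [] = refl
+v-identityʳ (x ∷ X) = cong₂ _∷_ (ℚP.+-identityʳ x) (+v-identityʳ X)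

+v-assoc : ∀ {d} (X Y Z : Pt d) → (X +v Y) +v Z ≡ X +v (Y +v Z)
+v-assoc [] [] [] = refl
+v-assoc (x ∷ X) (y ∷ Y) (z ∷ Z) = cong₂ _∷_ (ℚP.+-assoc x y z) (+v-assoc X Y Z)

+v-comm : ∀ {d} (X Y : Pt d) → X +v Y ≡ Y +v X
+v-comm [] [] = refl
+v-comm (x ∷ X) (y ∷ Y) = cong₂ _∷_ (ℚP.+-comm x y) (+v-comm X Y)

*s-identityˡ : ∀ {d} (X : Pt d) → 1ℚ *s X ≡ X
*s-identityˡ [] = refl
*s-identityˡ (x ∷ X) = cong₂ _∷_ (ℚP.*-identityˡ x) (*s-identityˡ X)

*s-zeroˡ : ∀ {d} (X : Pt d) → 0ℚ *s X ≡ 0v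
*s-zeroˡ [] = refl
*s-zeroˡ (x ∷ X) = cong₂ _∷_ (ℚP.*-zeroˡ x) (*s-zeroˡ X)

*s-zeroʳ : ∀ {d} (t : ℚ) → t *s 0v {d} ≡ 0v
*s-zeroʳ {zero} t = refl
*s-zeroʳ {suc d} t = cong₂ _∷_ (ℚP.*-zeroʳ t) (*s-zeroʳ t)

*s-distribˡ-+v : ∀ {d} (t : ℚ) (X Y : Pt d) → t *s (X +v Y) ≡ t *s X +v t *s Y
*s-distribˡ-+v t [] [] = refl
*s-distribˡ-+v t (x ∷ X) (y ∷ Y) = cong₂ _∷_ (ℚP.*-distribˡ-+ t x y) (*s-distribˡ-+v t X Y)

·-distrib-+v : ∀ {d} (u p q : Pt d) → u · (p +v q) ≡ u · p + u · q
·-distrib-+v [] [] [] = sym (ℚP.+-identityʳ 0ℚ)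
·-distrib-+v (a ∷ u) (b ∷ p) (c ∷ q) rewrite ·-distrib-+v u p q =
  solve 5 (λ a b c y z → a :* (b :+ c) :+ (y :+ z) := (a :* b :+ y) :+ (a :* c :+ z)) refl a b c (u · p) (u · q)

·-distrib--v : ∀ {d} (u p q : Pt d) → u · (p -v q) ≡ u · p - u · q
·-distrib--v [] [] [] = refl
·-distrib--v (a ∷ u) (b ∷ p) (c ∷ q) rewrite ·-distrib--v u p q =
  solve 5 (λ a b c y z → a :* (b :- c) :+ (y :- z) := (a :* b :+ y) :- (a :* c :+ z)) refl a b c (u · p) (u · q)

·-*s : ∀ {d} (u p : Pt d) t → u · (t *s p) ≡ t * (u · p)
·-*s [] [] t = sym (ℚP.*-zeroʳ t)
·-*s (a ∷ u) (b ∷ p) t rewrite ·-*s u p t =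
  solve 4 (λ a b t y → a :* (t :* b) :+ t :* y := t :* (a :* b :+ y)) refl a b t (u · p)

·-negv : ∀ {d} (u p : Pt d) → u · negv p ≡ - (u · p)
·-negv [] [] = refl
·-negv (a ∷ u) (b ∷ p) rewrite ·-negv u p =
  solve 3 (λ a b y → a :* (:- b) :+ (:- y) := :- (a :* b :+ y)) refl a b (u · p)

·-0v : ∀ {d} (u : Pt d) → u · 0v ≡ 0ℚ
·-0v [] = refl
·-0v (a ∷ u) rewrite ·-0v u = solve 1 (λ a → a :* con 0ℚ :+ con 0ℚ := con 0ℚ) refl a

·-combination : ∀ {d} (u X Y : Pt d) (α β : ℚ) → u · (α *s X +v β *s Y) ≡ α * (u · X) + β * (u · Y)
·-combination u X Y α β = trans (·-distrib-+v u _ _) (cong₂ _+_ (·-*s u X α) (·-*s u Y β))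

sumℚ-zero : ∀ {k} → sumℚ {k} (λ _ → 0ℚ) ≡ 0ℚ
sumℚ-zero {zero} = refl
sumℚ-zero {suc k} rewrite sumℚ-zero {k} = refl

all≡0⇒sumℚ≡0 : ∀ {k} (w : Fin k → ℚ) → (∀ i → w i ≡ 0ℚ) → sumℚ w ≡ 0ℚ
all≡0⇒sumℚ≡0 {zero} w w≡0 = refl
all≡0⇒sumℚ≡0 {suc k} w w≡0 rewrite w≡0 zero | all≡0⇒sumℚ≡0 (λ i → w (suc i)) (λ i → w≡0 (suc i)) = refl

sumℚ-nonneg : ∀ {k} (w : Fin k → ℚ) → (∀ i → 0ℚ ≤ w i) → 0ℚ ≤ sumℚ w
sumℚ-nonneg {zero} w w≥0 = ℚP.≤-refl
sumℚ-nonneg {suc k} w w≥0 = +-nonneg (w≥0 zero) (sumℚ-nonneg (λ i → w (suc i)) (λ i → w≥0 (suc i)))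

term≤sumℚ : ∀ {k} (w : Fin k → ℚ) → (∀ i → 0ℚ ≤ w i) → ∀ i → w i ≤ sumℚ w
term≤sumℚ {suc k} w w≥0 zero =
  0≤q-p⇒p≤q (subst (0ℚ ≤_) (solve 2 (λ a s → s := (a :+ s) :- a) refl (w zero) _)
    (sumℚ-nonneg (λ i → w (suc i)) (λ i → w≥0 (suc i))))
term≤sumℚ {suc k} w w≥0 (suc i) = ℚP.≤-trans (term≤sumℚ (λ i → w (suc i)) (λ i → w≥0 (suc i)) i)
  (0≤q-p⇒p≤q (subst (0ℚ ≤_) (solve 2 (λ a s → a := (a :+ s) :- s) refl (w zero) _) (w≥0 zero)))

sumℚ-linear : ∀ {k} (a b : ℚ) (f g : Fin k → ℚ) →
  sumℚ (λ r → a * f r + b * g r) ≡ a * sumℚ f + b * sumℚ g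
sumℚ-linear {zero} a b f g = solve 2 (λ a b → con 0ℚ := a :* con 0ℚ :+ b :* con 0ℚ) refl a b
sumℚ-linear {suc k} a b f g rewrite sumℚ-linear a b (λ i → f (suc i)) (λ i → g (suc i)) =
  solve 6 (λ a b x y X Y → (a :* x :+ b :* y) :+ (a :* X :+ b :* Y) := a :* (x :+ X) :+ b :* (y :+ Y)) refl
    a b (f zero) (g zero) (sumℚ (λ i → f (suc i))) (sumℚ (λ i → g (suc i)))

sumv-linear : ∀ {d k} (a b : ℚ) (f g : Fin k → ℚ) (V : Fin k → Pt d) →
  sumv (λ r → (a * f r + b * g r) *s V r) ≡ a *s sumv (λ r → f r *s V r) +v b *s sumv (λ r → g r *s V r)
sumv-linear {k = zero} a b f g V = zero-case a b
  where
  zero-case : ∀ {d} (a b : ℚ) → 0v {d} ≡ a *s 0v +v b *s 0v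
  zero-case {zero} a b = refl
  zero-case {suc d} a b =
    cong₂ _∷_ (solve 2 (λ a b → con 0ℚ := a :* con 0ℚ :+ b :* con 0ℚ) refl a b) (zero-case a b)
sumv-linear {k = suc k} a b f g V rewrite sumv-linear a b (λ i → f (suc i)) (λ i → g (suc i)) (λ i → V (suc i)) =
  step (f zero) (g zero) (V zero) _ _
  where
  step : ∀ {d} (x y : ℚ) (v S T : Pt d) →
    (a * x + b * y) *s v +v (a *s S +v b *s T) ≡ a *s (x *s v +v S) +v b *s (y *s v +v T)
  step x y [] [] [] = refl
  step x y (v ∷ vs) (s ∷ ss) (t ∷ ts) = cong₂ _∷_
    (solve 7 (λ a b x y v s t → (a :* x :+ b :* y) :* v :+ (a :* s :+ b :* t) := a :* (x :* v :+ s) :+ b :* (y :* v :+ t))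
      refl a b x y v s t)
    (step x y vs ss ts)

-- Convex hulls and their vertices

Convex : ∀ {n} → PtSet n → Set
Convex P = ∀ a b {p q} → 0ℚ ≤ a → 0ℚ ≤ b → a + b ≡ 1ℚ → P p → P q → P (a *s p +v b *s q)

Conv-convex : ∀ {d m} (V : Fin m → ZPt d) → Convex (Conv V)
Conv-convex V a b a≥0 b≥0 a+b≡1 (w₁ , w₁≥0 , Σw₁≡1 , Σw₁≡p) (w₂ , w₂≥0 , Σw₂≡1 , Σw₂≡q) =
  (λ r → a * w₁ r + b * w₂ r) ,
  (λ r → +-nonneg (*-nonneg a≥0 (w₁≥0 r)) (*-nonneg b≥0 (w₂≥0 r))) ,
  (begin
    sumℚ (λ r → a * w₁ r + b * w₂ r) ≡⟨ sumℚ-linear a b w₁ w₂ ⟩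
    a * sumℚ w₁ + b * sumℚ w₂        ≡⟨ cong₂ (λ s t → a * s + b * t) Σw₁≡1 Σw₂≡1 ⟩
    a * 1ℚ + b * 1ℚ                  ≡⟨ solve 2 (λ a b → a :* con 1ℚ :+ b :* con 1ℚ := a :+ b) refl a b ⟩
    a + b                            ≡⟨ a+b≡1 ⟩
    1ℚ                               ∎) ,
  trans (sumv-linear a b w₁ w₂ _) (cong₂ (λ s t → a *s s +v b *s t) Σw₁≡p Σw₂≡q)
  where open ≡-Reasoning

δ : ∀ {m} → Fin m → Fin m → ℚ
δ zero    zero    = 1ℚ
δ zero    (suc j) = 0ℚ
δ (suc i) zero    = 0ℚ
δ (suc i) (suc j) = δ i j

δ-cases : ∀ {m} (i j : Fin m) → (δ i j ≡ 0ℚ) ⊎ ((δ i j ≡ 1ℚ) × (j ≡ i))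
δ-cases zero    zero    = inj₂ (refl , refl)
δ-cases zero    (suc j) = inj₁ refl
δ-cases (suc i) zero    = inj₁ refl
δ-cases (suc i) (suc j) with δ-cases i j
... | inj₁ δ≡0 = inj₁ δ≡0
... | inj₂ (δ≡1 , refl) = inj₂ (δ≡1 , refl)

δ-nonneg : ∀ {m} (i j : Fin m) → 0ℚ ≤ δ i j
δ-nonneg i j with δ-cases i j
... | inj₁ δ≡0 = ℚP.≤-reflexive (sym δ≡0)
... | inj₂ (δ≡1 , _) = subst (0ℚ ≤_) (sym δ≡1) (ℚP.nonNegative⁻¹ 1ℚ)

sumℚ-δ : ∀ {m} (i : Fin m) → sumℚ (δ i) ≡ 1ℚ
sumℚ-δ {suc m} zero rewrite sumℚ-zero {m} = refl
sumℚ-δ {suc m} (suc i) rewrite sumℚ-δ i = refl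

sumv-zero : ∀ {d k} (W : Fin k → Pt d) → sumv (λ j → 0ℚ *s W j) ≡ 0v
sumv-zero {k = zero} W = refl
sumv-zero {k = suc k} W rewrite sumv-zero (λ j → W (suc j)) = trans (+v-identityʳ _) (*s-zeroˡ (W zero))

sumv-δ : ∀ {d m} (i : Fin m) (W : Fin m → Pt d) → sumv (λ j → δ i j *s W j) ≡ W i
sumv-δ {m = suc m} zero W rewrite sumv-zero (λ j → W (suc j)) = trans (+v-identityʳ _) (*s-identityˡ (W zero))
sumv-δ {m = suc m} (suc i) W rewrite sumv-δ i (λ j → W (suc j)) =
  trans (cong (_+v W (suc i)) (*s-zeroˡ (W zero))) (+v-identityˡ _)

½*p<1 : ∀ {p} → p ≤ 1ℚ → ½ * p < 1ℚ
½*p<1 {p} p≤1 = 0<q-p⇒p<q (subst (0ℚ <_) (solve 1 (λ p → con ½ :+ con ½ :* (con 1ℚ :- p) := con 1ℚ :- con ½ :* p) refl p)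
  (+-pos (ℚP.positive⁻¹ ½) (*-nonneg (ℚP.nonNegative⁻¹ ½) (p≤q⇒0≤q-p p≤1))))

segment-decomposition : ∀ {n} (t s : ℚ) → (1ℚ - t) * s ≡ 1ℚ → (p v : Pt n) →
  p ≡ t *s v +v (1ℚ - t) *s (s *s p +v (- (t * s)) *s v)
segment-decomposition t s [1-t]s≡1 [] [] = refl
segment-decomposition t s [1-t]s≡1 (a ∷ p) (v ∷ V) = cong₂ _∷_ (sym (begin
  t * v + (1ℚ - t) * (s * a + (- (t * s)) * v)
    ≡⟨ solve 4 (λ t s v a → t :* v :+ (con 1ℚ :- t) :* (s :* a :+ (:- (t :* s)) :* v)
                           := t :* v :+ ((con 1ℚ :- t) :* s) :* (a :- t :* v)) refl t s v a ⟩
  t * v + ((1ℚ - t) * s) * (a - t * v)  ≡⟨ cong (λ k → t * v + k * (a - t * v)) [1-t]s≡1 ⟩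
  t * v + 1ℚ * (a - t * v)              ≡⟨ solve 3 (λ t v a → t :* v :+ con 1ℚ :* (a :- t :* v) := a) refl t v a ⟩
  a                                     ∎)) (segment-decomposition t s [1-t]s≡1 p V)
  where open ≡-Reasoning

halved-weights-nonneg : ∀ {m} (i : Fin m) (w : Fin m → ℚ) (s : ℚ) → 0ℚ ≤ s → (∀ j → 0ℚ ≤ w j) →
  ∀ j → 0ℚ ≤ s * w j + (- ((½ * w i) * s)) * δ i j
halved-weights-nonneg i w s s≥0 w≥0 j with δ-cases i j
... | inj₁ δ≡0 = subst (λ z → 0ℚ ≤ s * w j + (- ((½ * w i) * s)) * z) (sym δ≡0)
  (subst (0ℚ ≤_) (solve 3 (λ s w t → s :* w := s :* w :+ (:- (t :* s)) :* con 0ℚ) refl s (w j) (½ * w i))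
    (*-nonneg s≥0 (w≥0 j)))
... | inj₂ (δ≡1 , refl) = subst (λ z → 0ℚ ≤ s * w i + (- ((½ * w i) * s)) * z) (sym δ≡1)
  (subst (0ℚ ≤_) (solve 2 (λ s w → s :* (con ½ :* w) := s :* w :+ (:- ((con ½ :* w) :* s)) :* con 1ℚ) refl s (w i))
    (*-nonneg s≥0 (*-nonneg (ℚP.nonNegative⁻¹ ½) (w≥0 i))))

module Generators {d m : ℕ} (V : Fin m → ZPt d) where

  generator∈Conv : ∀ i → Conv V (emb (V i))
  generator∈Conv i = δ i , δ-nonneg i , sumℚ-δ i , sumv-δ i (λ j → emb (V j))

  positive-weight : (w : Fin m → ℚ) → (∀ i → 0ℚ ≤ w i) → sumℚ w ≡ 1ℚ → Σ (Fin m) λ i → 0ℚ < w i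
  positive-weight w w≥0 Σw≡1 with FinP.any? (λ i → 0ℚ ℚP.<? w i)
  ... | yes found = found
  ... | no none = ⊥-elim (ℚP.1≢0 (trans (sym Σw≡1)
                    (all≡0⇒sumℚ≡0 w (λ i → ℚP.≤-antisym (ℚP.≮⇒≥ (λ wᵢ>0 → none (i , wᵢ>0))) (w≥0 i)))))

  -- Halving the weight of a generator Vᵢ exhibits p as an interior point of a segment from Vᵢ.
  split-off-generator : ∀ {p} (w : Fin m → ℚ) → (∀ j → 0ℚ ≤ w j) → sumℚ w ≡ 1ℚ →
    sumv (λ j → w j *s emb (V j)) ≡ p → ∀ i → 0ℚ < w i →
    Σ ℚ λ t → 0ℚ < t × t < 1ℚ × Σ (Pt d) λ r → Conv V r × (p ≡ t *s emb (V i) +v (1ℚ - t) *s r)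
  split-off-generator {p} w w≥0 Σw≡1 Σw≡p i wᵢ>0 =
    t , t>0 , t<1 , r , (ρ , ρ≥0 , Σρ≡1 , Σρ≡r) , segment-decomposition t s (ℚP.*-inverseʳ (1ℚ - t)) p Vᵢ
    where
    W : Fin m → Pt d
    W j = emb (V j)
    Vᵢ = W i
    t = ½ * w i
    t>0 : 0ℚ < t
    t>0 = *-pos (ℚP.positive⁻¹ ½) wᵢ>0
    t<1 : t < 1ℚ
    t<1 = ½*p<1 (subst (w i ≤_) Σw≡1 (term≤sumℚ w w≥0 i))
    1-t>0 = p<q⇒0<q-p t<1
    instance
      1-t≢0 : ℚ.NonZero (1ℚ - t)
      1-t≢0 = ℚ.>-nonZero 1-t>0
    s = 1/ (1ℚ - t)
    s≥0 = ℚP.<⇒≤ (1/-pos 1-t>0)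
    ρ : Fin m → ℚ
    ρ j = s * w j + (- (t * s)) * δ i j
    ρ≥0 : ∀ j → 0ℚ ≤ ρ j
    ρ≥0 = halved-weights-nonneg i w s s≥0 w≥0
    Σρ≡1 : sumℚ ρ ≡ 1ℚ
    Σρ≡1 = begin
      sumℚ ρ                                  ≡⟨ sumℚ-linear s (- (t * s)) w (δ i) ⟩
      s * sumℚ w + (- (t * s)) * sumℚ (δ i)   ≡⟨ cong₂ (λ a b → s * a + (- (t * s)) * b) Σw≡1 (sumℚ-δ i) ⟩
      s * 1ℚ + (- (t * s)) * 1ℚ               ≡⟨ solve 2 (λ s t → s :* con 1ℚ :+ (:- (t :* s)) :* con 1ℚ := (con 1ℚ :- t) :* s) refl s t ⟩
      (1ℚ - t) * s                            ≡⟨ ℚP.*-inverseʳ (1ℚ - t) ⟩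
      1ℚ                                      ∎
      where open ≡-Reasoning
    r = s *s p +v (- (t * s)) *s Vᵢ
    Σρ≡r : sumv (λ j → ρ j *s W j) ≡ r
    Σρ≡r = trans (sumv-linear s (- (t * s)) w (δ i) W) (cong₂ (λ a b → s *s a +v (- (t * s)) *s b) Σw≡p (sumv-δ i W))

  vertex-is-generator : ∀ p → IsVertex (Conv V) p → Σ (Fin m) λ i → p ≡ emb (V i)
  vertex-is-generator p ((w , w≥0 , Σw≡1 , Σw≡p) , extreme) = i , (begin
      p                                             ≡⟨ p≡ ⟩
      t *s emb (V i) +v (1ℚ - t) *s r               ≡⟨ cong (λ y → t *s emb (V i) +v (1ℚ - t) *s y) (sym Vᵢ≡r) ⟩
      t *s emb (V i) +v (1ℚ - t) *s emb (V i)       ≡⟨ split-trivially (emb (V i)) ⟩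
      emb (V i)                                     ∎)
    where
    open ≡-Reasoning
    i = proj₁ (positive-weight w w≥0 Σw≡1)
    S = split-off-generator w w≥0 Σw≡1 Σw≡p i (proj₂ (positive-weight w w≥0 Σw≡1))
    t = proj₁ S
    r = proj₁ (proj₂ (proj₂ (proj₂ S)))
    p≡ = proj₂ (proj₂ (proj₂ (proj₂ (proj₂ S))))
    Vᵢ≡r : emb (V i) ≡ r
    Vᵢ≡r = extreme (emb (V i)) r t (generator∈Conv i) (proj₁ (proj₂ (proj₂ (proj₂ (proj₂ S)))))
             (proj₁ (proj₂ S)) (proj₁ (proj₂ (proj₂ S))) p≡
    split-trivially : ∀ {n} (X : Pt n) → t *s X +v (1ℚ - t) *s X ≡ X
    split-trivially [] = refl
    split-trivially (a ∷ X) =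
      cong₂ _∷_ (solve 2 (λ t a → t :* a :+ (con 1ℚ :- t) :* a := a) refl t a) (split-trivially X)

-- Linear dependence

lincomb : ∀ {n k} → Vec ℚ k → Vec (Pt n) k → Pt n
lincomb []       []       = 0v
lincomb (a ∷ as) (v ∷ vs) = a *s v +v lincomb as vs

LinearlyDependent : ∀ {n k} → Vec (Pt n) k → Set
LinearlyDependent {k = k} vs = Σ (Vec ℚ k) λ l → lincomb l vs ≡ 0v × ¬ All (_≡ 0ℚ) l

lincomb-++ : ∀ {n a b} (l₁ : Vec ℚ a) (l₂ : Vec ℚ b) (vs : Vec (Pt n) a) (ws : Vec (Pt n) b) →
  lincomb (l₁ ++ l₂) (vs ++ ws) ≡ lincomb l₁ vs +v lincomb l₂ ws
lincomb-++ [] l₂ [] ws = sym (+v-identityˡ _)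
lincomb-++ (a ∷ l₁) l₂ (v ∷ vs) ws rewrite lincomb-++ l₁ l₂ vs ws = sym (+v-assoc _ _ _)

lincomb-tabulate : ∀ {n k} (l : Vec ℚ k) (f : Fin k → Pt n) → lincomb l (tabulate f) ≡ sumv (λ i → lookup l i *s f i)
lincomb-tabulate [] f = refl
lincomb-tabulate (a ∷ l) f rewrite lincomb-tabulate l (λ i → f (suc i)) = refl

·-lincomb-tabulate : ∀ {n k} (u : Pt n) (l : Vec ℚ k) (f : Fin k → Pt n) → (∀ i → u · f i ≡ 0ℚ) →
  u · lincomb l (tabulate f) ≡ 0ℚ
·-lincomb-tabulate u [] f u⊥f = ·-0v u
·-lincomb-tabulate u (a ∷ l) f u⊥f
  rewrite ·-distrib-+v u (a *s f zero) (lincomb l (tabulate (λ i → f (suc i))))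
        | ·-*s u (f zero) a | u⊥f zero | ·-lincomb-tabulate u l (λ i → f (suc i)) (λ i → u⊥f (suc i)) =
  solve 1 (λ a → a :* con 0ℚ :+ con 0ℚ := con 0ℚ) refl a

lincomb-head-0 : ∀ {n k} (l : Vec ℚ k) (vs : Vec (Pt n) k) → lincomb l (map (0ℚ ∷_) vs) ≡ 0ℚ ∷ lincomb l vs
lincomb-head-0 [] [] = refl
lincomb-head-0 (a ∷ l) (v ∷ vs) rewrite lincomb-head-0 l vs =
  cong (_∷ (a *s v +v lincomb l vs)) (solve 1 (λ a → a :* con 0ℚ :+ con 0ℚ := con 0ℚ) refl a)

lincomb-head-tail : ∀ {n k} (l : Vec ℚ k) (vs : Vec (Pt (suc n)) k) →
  lincomb l vs ≡ (l · map head vs) ∷ lincomb l (map tail vs)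
lincomb-head-tail [] [] = refl
lincomb-head-tail (a ∷ l) ((h ∷ t) ∷ vs) rewrite lincomb-head-tail l vs = refl

lincomb-cleared : ∀ {n k} (c : ℚ) (t : Pt n) (l : Vec ℚ k) (vs : Vec (Pt (suc n)) k) →
  lincomb l (map (λ v → tail v -v (head v * c) *s t) vs) ≡ lincomb l (map tail vs) -v ((l · map head vs) * c) *s t
lincomb-cleared c t [] [] = empty t
  where
  empty : ∀ {n} (t : Pt n) → 0v ≡ 0v -v (0ℚ * c) *s t
  empty [] = refl
  empty (y ∷ t) = cong₂ _∷_ (solve 2 (λ c y → con 0ℚ := con 0ℚ :- (con 0ℚ :* c) :* y) refl c y) (empty t)
lincomb-cleared c t (a ∷ l) ((h ∷ tv) ∷ vs) rewrite lincomb-cleared c t l vs =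
  step tv t (lincomb l (map tail vs))
  where
  S = l · map head vs
  step : ∀ {n} (tv t B : Pt n) → a *s (tv -v (h * c) *s t) +v (B -v (S * c) *s t) ≡ (a *s tv +v B) -v ((a * h + S) * c) *s t
  step [] [] [] = refl
  step (x ∷ tv) (y ∷ t) (b ∷ B) = cong₂ _∷_
    (solve 7 (λ a h c S x y b → a :* (x :- (h :* c) :* y) :+ (b :- (S :* c) :* y) := (a :* x :+ b) :- ((a :* h :+ S) :* c) :* y)
      refl a h c S x y b)
    (step tv t B)

pivot-cancels : ∀ S c h → h * c ≡ 1ℚ → 0ℚ + (- (S * c) * h + S) ≡ 0ℚ
pivot-cancels S c h hc≡1 = begin
  0ℚ + (- (S * c) * h + S) ≡⟨ solve 3 (λ S c h → con 0ℚ :+ ((:- (S :* c)) :* h :+ S) := S :- S :* (h :* c)) refl S c h ⟩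
  S - S * (h * c)          ≡⟨ cong (λ r → S - S * r) hc≡1 ⟩
  S - S * 1ℚ               ≡⟨ solve 1 (λ S → S :- S :* con 1ℚ := con 0ℚ) refl S ⟩
  0ℚ                       ∎
  where open ≡-Reasoning

neg*s+v≡-v*s : ∀ {n} (s : ℚ) (t B : Pt n) → (- s) *s t +v B ≡ B -v s *s t
neg*s+v≡-v*s s [] [] = refl
neg*s+v≡-v*s s (y ∷ t) (z ∷ B) =
  cong₂ _∷_ (solve 3 (λ s y z → (:- s) :* y :+ z := z :- s :* y) refl s y z) (neg*s+v≡-v*s s t B)

-- Gaussian elimination on the first coordinate. The vectors in `reduced` have first coordinate 0 (only
-- their tails are stored). The next vector of `vs` joins them if its first coordinate is 0; otherwise it
-- is the pivot that clears the first coordinate of the remaining ones, and the induction hypothesis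
-- applies to all the tails.
dependent-after-reduction : ∀ n → (∀ k → n ℕ.< k → (vs : Vec (Pt n) k) → LinearlyDependent vs) →
  ∀ {a b} (reduced : Vec (Pt n) a) (vs : Vec (Pt (suc n)) b) → suc n ℕ.< a ℕ.+ b →
  Σ (Vec ℚ a) λ l₁ → Σ (Vec ℚ b) λ l₂ →
    (lincomb l₁ (map (0ℚ ∷_) reduced) +v lincomb l₂ vs ≡ 0v) × ¬ (All (_≡ 0ℚ) l₁ × All (_≡ 0ℚ) l₂)
dependent-after-reduction n ih {a} reduced [] n<a+0 with ih a (ℕP.<-trans (ℕP.n<1+n n) (subst (suc n ℕ.<_) (ℕP.+-identityʳ a) n<a+0)) reduced
... | l , l·reduced≡0 , l≢0 =
  l , [] , trans (+v-identityʳ _) (trans (lincomb-head-0 l reduced) (cong (0ℚ ∷_) l·reduced≡0)) , λ (l≡0 , _) → l≢0 l≡0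
dependent-after-reduction n ih {a} {suc b} reduced ((h ∷ t) ∷ vs) n<a+b with h ℚP.≟ 0ℚ
... | yes refl with dependent-after-reduction n ih (t ∷ reduced) vs (subst (suc n ℕ.<_) (ℕP.+-suc a b) n<a+b)
...   | α ∷ l₁ , l₂ , combination≡0 , nontrivial =
  l₁ , α ∷ l₂ , trans (sym (+v-assoc _ _ _)) (trans (cong (_+v _) (+v-comm _ _)) combination≡0) ,
  λ { (l₁≡0 , (α≡0 ∷ l₂≡0)) → nontrivial (α≡0 ∷ l₁≡0 , l₂≡0) }
dependent-after-reduction n ih {a} {suc b} reduced ((h ∷ t) ∷ vs) n<a+b | no h≢0 =
  l₁ , β ∷ l₂ , combination≡0 , λ { (l₁≡0 , (_ ∷ l₂≡0)) → l≢0 (subst (All (_≡ 0ℚ)) (sym l≡l₁++l₂) (++⁺ l₁≡0 l₂≡0)) }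
  where
  instance
    h≢0′ : ℚ.NonZero h
    h≢0′ = ℚ.≢-nonZero h≢0
  c = 1/ h
  cleared = map (λ v → tail v -v (head v * c) *s t) vs
  tails-dependent = ih (a ℕ.+ b) (ℕP.≤-pred (subst (suc n ℕ.<_) (ℕP.+-suc a b) n<a+b)) (reduced ++ cleared)
  l = proj₁ tails-dependent
  l≢0 = proj₂ (proj₂ tails-dependent)
  l₁ = proj₁ (splitAt a l)
  l₂ = proj₁ (proj₂ (splitAt a l))
  l≡l₁++l₂ = proj₂ (proj₂ (splitAt a l))
  S = l₂ · map head vs
  β = - (S * c)
  tails≡0 : lincomb l₁ reduced +v (lincomb l₂ (map tail vs) -v (S * c) *s t) ≡ 0v
  tails≡0 = begin
    lincomb l₁ reduced +v (lincomb l₂ (map tail vs) -v (S * c) *s t) ≡⟨ cong (lincomb l₁ reduced +v_) (sym (lincomb-cleared c t l₂ vs)) ⟩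
    lincomb l₁ reduced +v lincomb l₂ cleared                          ≡⟨ sym (lincomb-++ l₁ l₂ reduced cleared) ⟩
    lincomb (l₁ ++ l₂) (reduced ++ cleared)                           ≡⟨ cong (λ m → lincomb m (reduced ++ cleared)) (sym l≡l₁++l₂) ⟩
    lincomb l (reduced ++ cleared)                                    ≡⟨ proj₁ (proj₂ tails-dependent) ⟩
    0v                                                                ∎
    where open ≡-Reasoning
  combination≡0 : lincomb l₁ (map (0ℚ ∷_) reduced) +v (β *s (h ∷ t) +v lincomb l₂ vs) ≡ 0v
  combination≡0 rewrite lincomb-head-0 l₁ reduced | lincomb-head-tail l₂ vs =
    cong₂ _∷_ (pivot-cancels S c h (ℚP.*-inverseʳ h))
      (trans (cong (lincomb l₁ reduced +v_) (neg*s+v≡-v*s (S * c) t (lincomb l₂ (map tail vs)))) tails≡0)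

>dim⇒linearlyDependent : ∀ n k → n ℕ.< k → (vs : Vec (Pt n) k) → LinearlyDependent vs
>dim⇒linearlyDependent zero (suc k) _ vs = (1ℚ ∷ replicate k 0ℚ) , Pt0-trivial _ , λ { (1≡0 ∷ _) → ℚP.1≢0 1≡0 }
>dim⇒linearlyDependent (suc n) k n<k vs with dependent-after-reduction n (>dim⇒linearlyDependent n) [] vs n<k
... | [] , l , l·vs≡0 , l≢0 = l , trans (sym (+v-identityˡ _)) l·vs≡0 , λ l≡0 → l≢0 ([] , l≡0)

-- The affine hull of a facet

sumv-differences : ∀ {n k} (f : Fin k → ℚ) (A : Fin k → Pt n) (A₀ : Pt n) →
  sumv (λ i → f i *s (A i -v A₀)) ≡ (- sumℚ f) *s A₀ +v sumv (λ i → f i *s A i)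
sumv-differences {k = zero} f A A₀ = empty A₀
  where
  empty : ∀ {n} (A₀ : Pt n) → 0v ≡ (- 0ℚ) *s A₀ +v 0v
  empty [] = refl
  empty (a ∷ A₀) = cong₂ _∷_ (solve 1 (λ a → con 0ℚ := (:- con 0ℚ) :* a :+ con 0ℚ) refl a) (empty A₀)
sumv-differences {k = suc k} f A A₀ rewrite sumv-differences (λ i → f (suc i)) (λ i → A (suc i)) A₀ =
  step (f zero) (A zero) A₀ (sumv (λ i → f (suc i) *s A (suc i))) (sumℚ (λ i → f (suc i)))
  where
  step : ∀ {n} (c : ℚ) (A A₀ S : Pt n) (σ : ℚ) →
    c *s (A -v A₀) +v ((- σ) *s A₀ +v S) ≡ (- (c + σ)) *s A₀ +v (c *s A +v S)
  step c [] [] [] σ = refl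
  step c (a ∷ A) (a₀ ∷ A₀) (s ∷ S) σ = cong₂ _∷_
    (solve 5 (λ c a a₀ s σ → c :* (a :- a₀) :+ ((:- σ) :* a₀ :+ s) := (:- (c :+ σ)) :* a₀ :+ (c :* a :+ s)) refl c a a₀ s σ)
    (step c A A₀ S σ)

*s-sumv : ∀ {n k} (c : ℚ) (f : Fin k → ℚ) (A : Fin k → Pt n) →
  c *s sumv (λ i → f i *s A i) ≡ sumv (λ i → (c * f i) *s A i)
*s-sumv {k = zero} c f A = *s-zeroʳ c
*s-sumv {k = suc k} c f A rewrite *s-distribˡ-+v c (f zero *s A zero) (sumv (λ i → f (suc i) *s A (suc i)))
                                | *s-sumv c (λ i → f (suc i)) (λ i → A (suc i)) =
  cong (_+v sumv (λ i → (c * f (suc i)) *s A (suc i))) (*s-assoc (A zero))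
  where
  *s-assoc : ∀ {n} (X : Pt n) → c *s (f zero *s X) ≡ (c * f zero) *s X
  *s-assoc [] = refl
  *s-assoc (x ∷ X) = cong₂ _∷_ (sym (ℚP.*-assoc c (f zero) x)) (*s-assoc X)

solve-linear : ∀ {n} (a i : ℚ) → a * i ≡ 1ℚ → (g L : Pt n) → a *s g +v L ≡ 0v → g ≡ (- i) *s L
solve-linear a i ai≡1 [] [] _ = refl
solve-linear a i ai≡1 (y ∷ g) (z ∷ L) ag+L≡0 = cong₂ _∷_ (begin
  y                            ≡⟨ solve 1 (λ y → y := y :* con 1ℚ) refl y ⟩
  y * 1ℚ                       ≡⟨ cong (y *_) (sym ai≡1) ⟩
  y * (a * i)                  ≡⟨ solve 4 (λ y a i z → y :* (a :* i) := i :* (a :* y :+ z) :- i :* z) refl y a i z ⟩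
  i * (a * y + z) - i * z      ≡⟨ cong (λ r → i * r - i * z) (cong head ag+L≡0) ⟩
  i * 0ℚ - i * z               ≡⟨ solve 2 (λ i z → i :* con 0ℚ :- i :* z := (:- i) :* z) refl i z ⟩
  (- i) * z                    ∎) (solve-linear a i ai≡1 g L (cong tail ag+L≡0))
  where open ≡-Reasoning

module AffineHull {n : ℕ} (F : PtSet n) where

  differences : ∀ {k} → (Fin (suc k) → Pt n) → Fin k → Pt n
  differences p i = p (suc i) -v p zero

  translate-by-differences∈aff : ∀ {k x} (p : Fin (suc k) → Pt n) → F x → (∀ i → F (p i)) →
    (μ : Fin k → ℚ) → InAff F (x +v sumv (λ i → μ i *s differences p i))
  translate-by-differences∈aff {k} {x} p x∈F p∈F μ = suc (suc k) , q , w , q∈F , Σw≡1 , Σwq≡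
    where
    q : Fin (suc (suc k)) → Pt n
    q zero          = x
    q (suc zero)    = p zero
    q (suc (suc i)) = p (suc i)
    w : Fin (suc (suc k)) → ℚ
    w zero          = 1ℚ
    w (suc zero)    = - sumℚ μ
    w (suc (suc i)) = μ i
    q∈F : ∀ i → F (q i)
    q∈F zero          = x∈F
    q∈F (suc zero)    = p∈F zero
    q∈F (suc (suc i)) = p∈F (suc i)
    Σw≡1 : sumℚ w ≡ 1ℚ
    Σw≡1 = solve 1 (λ s → con 1ℚ :+ ((:- s) :+ s) := con 1ℚ) refl (sumℚ μ)
    Σwq≡ : sumv (λ i → w i *s q i) ≡ x +v sumv (λ i → μ i *s differences p i)
    Σwq≡ = cong₂ _+v_ (*s-identityˡ x) (sym (sumv-differences μ (λ i → p (suc i)) (p zero)))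

module FacetHyperplane {d : ℕ} (F : PtSet (suc d)) (u : Pt (suc d))
  (u≡1-on-F : ∀ p → F p → u · p ≡ 1ℚ) {x : Pt (suc d)} (x∈F : F x) (dim-F : DimAtLeast F d) where

  open AffineHull F

  p = proj₁ dim-F
  p∈F = proj₁ (proj₂ dim-F)
  p-independent = proj₂ (proj₂ dim-F)

  u⊥differences : ∀ i → u · differences p i ≡ 0ℚ
  u⊥differences i rewrite ·-distrib--v u (p (suc i)) (p zero) | u≡1-on-F _ (p∈F (suc i)) | u≡1-on-F _ (p∈F zero) =
    ℚP.+-inverseʳ 1ℚ

  x-coefficient≡0 : ∀ {g l₀ l₁} (l : Vec ℚ d) → u · g ≡ 0ℚ →
    l₀ *s g +v (l₁ *s x +v lincomb l (tabulate (differences p))) ≡ 0v → l₁ ≡ 0ℚ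
  x-coefficient≡0 {g} {l₀} {l₁} l u·g≡0 dependence = begin
    l₁                                          ≡⟨ solve 2 (λ l₀ l₁ → l₁ := l₀ :* con 0ℚ :+ (l₁ :* con 1ℚ :+ con 0ℚ)) refl l₀ l₁ ⟩
    l₀ * 0ℚ + (l₁ * 1ℚ + 0ℚ)                    ≡⟨ sym (cong₂ (λ r s → l₀ * r + (l₁ * s + 0ℚ)) u·g≡0 (u≡1-on-F _ x∈F)) ⟩
    l₀ * (u · g) + (l₁ * (u · x) + 0ℚ)          ≡⟨ cong (λ r → l₀ * (u · g) + (l₁ * (u · x) + r))
                                                        (sym (·-lincomb-tabulate u l (differences p) u⊥differences)) ⟩
    l₀ * (u · g) + (l₁ * (u · x) + u · L)       ≡⟨ sym (cong (l₀ * (u · g) +_) (trans (·-distrib-+v u _ _) (cong (_+ u · L) (·-*s u x l₁)))) ⟩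
    l₀ * (u · g) + u · (l₁ *s x +v L)           ≡⟨ sym (trans (·-distrib-+v u _ _) (cong (_+ u · (l₁ *s x +v L)) (·-*s u g l₀))) ⟩
    u · (l₀ *s g +v (l₁ *s x +v L))             ≡⟨ cong (u ·_) dependence ⟩
    u · 0v                                      ≡⟨ ·-0v u ⟩
    0ℚ                                          ∎
    where
    open ≡-Reasoning
    L = lincomb l (tabulate (differences p))

  -- Take a dependence among g, x and the d differences: u kills g and the differences but not x, so x
  -- does not occur, and g must occur since the differences are independent.
  u⊥⊆span-differences : ∀ g → u · g ≡ 0ℚ → Σ (Fin d → ℚ) λ μ → g ≡ sumv (λ i → μ i *s differences p i)
  u⊥⊆span-differences g u·g≡0 with >dim⇒linearlyDependent (suc d) (suc (suc d)) (ℕP.n<1+n _) (g ∷ x ∷ tabulate (differences p))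
  ... | (l₀ ∷ l₁ ∷ l) , dependence , nontrivial = solve-for-g (l₀ ℚP.≟ 0ℚ)
    where
    L = lincomb l (tabulate (differences p))
    L≡Σ = lincomb-tabulate l (differences p)
    l₁≡0 : l₁ ≡ 0ℚ
    l₁≡0 = x-coefficient≡0 {g} {l₀} l u·g≡0 dependence
    l₀g+L≡0 : l₀ *s g +v L ≡ 0v
    l₀g+L≡0 = trans (cong (l₀ *s g +v_) (sym (drop-zero x L))) (subst (λ r → l₀ *s g +v (r *s x +v L) ≡ 0v) l₁≡0 dependence)
      where
      drop-zero : ∀ {n} (x L : Pt n) → 0ℚ *s x +v L ≡ L
      drop-zero x L = trans (cong (_+v L) (*s-zeroˡ x)) (+v-identityˡ L)
    solve-for-g : Dec (l₀ ≡ 0ℚ) → Σ (Fin d → ℚ) λ μ → g ≡ sumv (λ i → μ i *s differences p i)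
    solve-for-g (yes l₀≡0) = ⊥-elim (nontrivial (l₀≡0 ∷ l₁≡0 ∷ lookup⁻ (p-independent (lookup l) Σ≡0)))
      where
      Σ≡0 : sumv (λ i → lookup l i *s differences p i) ≡ 0v
      Σ≡0 = begin
        sumv (λ i → lookup l i *s differences p i) ≡⟨ L≡Σ ⟨
        L                                         ≡⟨ +v-identityˡ L ⟨
        0v +v L                                   ≡⟨ cong (_+v L) (*s-zeroˡ g) ⟨
        0ℚ *s g +v L                              ≡⟨ subst (λ r → r *s g +v L ≡ 0v) l₀≡0 l₀g+L≡0 ⟩
        0v                                        ∎
        where open ≡-Reasoning
    solve-for-g (no l₀≢0) = (λ i → (- 1/ l₀) * lookup l i) , (begin
      g                                                     ≡⟨ solve-linear l₀ (1/ l₀) (ℚP.*-inverseʳ l₀) g L l₀g+L≡0 ⟩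
      (- 1/ l₀) *s L                                        ≡⟨ cong ((- 1/ l₀) *s_) L≡Σ ⟩
      (- 1/ l₀) *s sumv (λ i → lookup l i *s differences p i) ≡⟨ *s-sumv (- 1/ l₀) (lookup l) (differences p) ⟩
      sumv (λ i → ((- 1/ l₀) * lookup l i) *s differences p i) ∎)
      where
      open ≡-Reasoning
      instance
        l₀≢0′ : ℚ.NonZero l₀
        l₀≢0′ = ℚ.≢-nonZero l₀≢0

  u⊥⊆aff : ∀ g → u · g ≡ 0ℚ → InAff F (x +v g)
  u⊥⊆aff g u·g≡0 with u⊥⊆span-differences g u·g≡0
  ... | μ , g≡ = subst (λ h → InAff F (x +v h)) (sym g≡) (translate-by-differences∈aff p x∈F p∈F μ)

-- Neighbourhoods of a relative interior point of a facet

‖_‖₁ : ∀ {n} → Pt n → ℚ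
‖ [] ‖₁    = 0ℚ
‖ a ∷ v ‖₁ = ∣ a ∣ + ‖ v ‖₁

‖‖₁-nonneg : ∀ {n} (v : Pt n) → 0ℚ ≤ ‖ v ‖₁
‖‖₁-nonneg []      = ℚP.≤-refl
‖‖₁-nonneg (a ∷ v) = +-nonneg (ℚP.0≤∣p∣ a) (‖‖₁-nonneg v)

Small-‖‖₁ : ∀ {n} (v : Pt n) → Small ‖ v ‖₁ v
Small-‖‖₁ [] = []
Small-‖‖₁ (a ∷ v) =
  0≤q-p⇒p≤q (subst (0ℚ ≤_) (solve 2 (λ A N → N := (A :+ N) :- A) refl ∣ a ∣ ‖ v ‖₁) (‖‖₁-nonneg v)) ∷
  All.map (λ ∣b∣≤‖v‖ → ℚP.≤-trans ∣b∣≤‖v‖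
    (0≤q-p⇒p≤q (subst (0ℚ ≤_) (solve 2 (λ A N → A := (A :+ N) :- N) refl ∣ a ∣ ‖ v ‖₁) (ℚP.0≤∣p∣ a))))
    (Small-‖‖₁ v)

Small-mono : ∀ {n} {r r′ : ℚ} {f : Pt n} → r ≤ r′ → Small r f → Small r′ f
Small-mono r≤r′ = All.map (λ ∣y∣≤r → ℚP.≤-trans ∣y∣≤r r≤r′)

∣*∣≤ : ∀ a {y e} → ∣ y ∣ ≤ e → ∣ a * y ∣ ≤ ∣ a ∣ * e
∣*∣≤ a {y} {e} ∣y∣≤e = subst (_≤ ∣ a ∣ * e) (sym (ℚP.∣p*q∣≡∣p∣*∣q∣ a y))
  (ℚP.*-monoˡ-≤-nonNeg ∣ a ∣ {{ℚ.nonNegative (ℚP.0≤∣p∣ a)}} ∣y∣≤e)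

Small-*s : ∀ {n} {r s : ℚ} (f : Pt n) → 0ℚ ≤ s → Small r f → Small (s * r) (s *s f)
Small-*s [] s≥0 [] = []
Small-*s {r = r} {s} (y ∷ f) s≥0 (∣y∣≤r ∷ small) =
  subst (λ z → ∣ s * y ∣ ≤ z * r) (ℚP.0≤p⇒∣p∣≡p s≥0) (∣*∣≤ s ∣y∣≤r) ∷ Small-*s f s≥0 small

Small--v*s : ∀ {n} {ε τ t : ℚ} (e c : Pt n) → Small ε e → ∣ t ∣ ≤ τ → Small (ε + τ * ‖ c ‖₁) (e -v t *s c)
Small--v*s {ε = ε} {τ} {t} e c e-small ∣t∣≤τ = go e c e-small (Small-‖‖₁ c)
  where
  τ≥0 = ℚP.≤-trans (ℚP.0≤∣p∣ t) ∣t∣≤τ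
  go : ∀ {n} (e c : Pt n) → Small ε e → ∀ {B} → All (λ y → ∣ y ∣ ≤ B) c → Small (ε + τ * B) (e -v t *s c)
  go [] [] [] [] = []
  go (y ∷ e) (z ∷ c) (∣y∣≤ε ∷ e-small) {B} (∣z∣≤B ∷ c-small) =
    ℚP.≤-trans (ℚP.∣p-q∣≤∣p∣+∣q∣ y (t * z)) (ℚP.+-mono-≤ ∣y∣≤ε ∣tz∣≤τB) ∷ go e c e-small c-small
    where
    ∣tz∣≤τB : ∣ t * z ∣ ≤ τ * B
    ∣tz∣≤τB = subst (_≤ τ * B) (sym (ℚP.∣p*q∣≡∣p∣*∣q∣ t z))
      (ℚP.≤-trans (*-monoʳ-≤-nonneg ∣t∣≤τ (ℚP.0≤∣p∣ z)) (ℚP.*-monoˡ-≤-nonNeg τ {{ℚ.nonNegative τ≥0}} ∣z∣≤B))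

·-bound : ∀ {n} (ε : ℚ) (u e : Pt n) → Small ε e → ∣ u · e ∣ ≤ ‖ u ‖₁ * ε
·-bound ε [] [] [] = ℚP.≤-reflexive (sym (ℚP.*-zeroˡ ε))
·-bound ε (a ∷ u) (y ∷ e) (∣y∣≤ε ∷ e-small) =
  ℚP.≤-trans (ℚP.∣p+q∣≤∣p∣+∣q∣ (a * y) (u · e))
    (subst (∣ a * y ∣ + ∣ u · e ∣ ≤_) (sym (ℚP.*-distribʳ-+ ε ∣ a ∣ ‖ u ‖₁))
      (ℚP.+-mono-≤ (∣*∣≤ a ∣y∣≤ε) (·-bound ε u e e-small)))

*-cancelˡ-≡0 : ∀ s y → s ≢ 0ℚ → s * y ≡ 0ℚ → y ≡ 0ℚ
*-cancelˡ-≡0 s y s≢0 sy≡0 = begin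
  y              ≡⟨ sym (ℚP.*-identityˡ y) ⟩
  1ℚ * y         ≡⟨ cong (_* y) (sym (ℚP.*-inverseˡ s)) ⟩
  (1/ s * s) * y ≡⟨ ℚP.*-assoc (1/ s) s y ⟩
  1/ s * (s * y) ≡⟨ cong (1/ s *_) sy≡0 ⟩
  1/ s * 0ℚ      ≡⟨ ℚP.*-zeroʳ (1/ s) ⟩
  0ℚ             ∎
  where
  open ≡-Reasoning
  instance
    s≢0′ : ℚ.NonZero s
    s≢0′ = ℚ.≢-nonZero s≢0

positive-multiple-below : ∀ {e B} → 0ℚ < e → 0ℚ ≤ B → Σ ℚ λ s → 0ℚ < s × s * B ≤ e
positive-multiple-below {e} {B} e>0 B≥0 = s , *-pos e>0 (1/-pos K>0) , 0≤q-p⇒p≤q (subst (0ℚ ≤_) e-sB≡s (ℚP.<⇒≤ (*-pos e>0 (1/-pos K>0))))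
  where
  K>0 : 0ℚ < 1ℚ + B
  K>0 = +-pos (ℚP.positive⁻¹ 1ℚ) B≥0
  instance
    K≢0 : ℚ.NonZero (1ℚ + B)
    K≢0 = ℚ.>-nonZero K>0
  s = e * 1/ (1ℚ + B)
  e-sB≡s : s ≡ e - s * B
  e-sB≡s = begin
    s                          ≡⟨ solve 3 (λ e i B → e :* i := e :* (i :* (con 1ℚ :+ B)) :- (e :* i) :* B) refl e (1/ (1ℚ + B)) B ⟩
    e * (1/ (1ℚ + B) * (1ℚ + B)) - s * B ≡⟨ cong (λ r → e * r - s * B) (ℚP.*-inverseˡ (1ℚ + B)) ⟩
    e * 1ℚ - s * B             ≡⟨ cong (_- s * B) (ℚP.*-identityʳ e) ⟩
    e - s * B                  ∎
    where open ≡-Reasoning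

ε-for-linear-bounds : ∀ {m A B} → 0ℚ < m → 0ℚ ≤ A → 0ℚ ≤ B →
  Σ ℚ λ ε → 0ℚ < ε × A * ε ≤ m × ε + (A * ε) * B ≤ m
ε-for-linear-bounds {m} {A} {B} m>0 A≥0 B≥0 = ε , ε>0 ,
  subst (A * ε ≤_) εK≡m (0≤q-p⇒p≤q (subst (0ℚ ≤_) (solve 3 (λ ε A B → ε :* (con 1ℚ :+ A :* B) := ε :* (con 1ℚ :+ A :+ A :* B) :- A :* ε) refl ε A B)
    (*-nonneg ε≥0 (+-nonneg (ℚP.nonNegative⁻¹ 1ℚ) (*-nonneg A≥0 B≥0))))) ,
  subst (ε + (A * ε) * B ≤_) εK≡m (0≤q-p⇒p≤q (subst (0ℚ ≤_) (solve 3 (λ ε A B → ε :* A := ε :* (con 1ℚ :+ A :+ A :* B) :- (ε :+ (A :* ε) :* B)) refl ε A B)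
    (*-nonneg ε≥0 A≥0)))
  where
  K = 1ℚ + A + A * B
  K>0 : 0ℚ < K
  K>0 = subst (0ℚ <_) (sym (ℚP.+-assoc 1ℚ A (A * B))) (+-pos (ℚP.positive⁻¹ 1ℚ) (+-nonneg A≥0 (*-nonneg A≥0 B≥0)))
  instance
    K≢0 : ℚ.NonZero K
    K≢0 = ℚ.>-nonZero K>0
  ε = m * 1/ K
  ε>0 = *-pos m>0 (1/-pos K>0)
  ε≥0 = ℚP.<⇒≤ ε>0
  εK≡m : ε * K ≡ m
  εK≡m = trans (ℚP.*-assoc m (1/ K) K) (trans (cong (m *_) (ℚP.*-inverseˡ K)) (ℚP.*-identityʳ m))

tilted-weight-bounds : ∀ {α t γ} → ∣ t ∣ ≤ γ → γ ≤ ½ * α → γ ≤ ½ * (1ℚ - α) →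
  (½ * α ≤ α + t) × (0ℚ ≤ 1ℚ - (α + t))
tilted-weight-bounds {α} {t} {γ} ∣t∣≤γ γ≤α/2 γ≤[1-α]/2 =
  0≤q-p⇒p≤q (subst (0ℚ ≤_) (solve 3 (λ α γ t → (con ½ :* α :- γ) :+ (t :- (:- γ)) := (α :+ t) :- con ½ :* α) refl α γ t)
    (+-nonneg (p≤q⇒0≤q-p γ≤α/2) (p≤q⇒0≤q-p (∣p∣≤q⇒-q≤p ∣t∣≤γ)))) ,
  subst (0ℚ ≤_) (solve 3 (λ α γ t → (con ½ :* (con 1ℚ :- α) :- γ) :+ ((γ :- t) :+ con ½ :* (con 1ℚ :- α)) := con 1ℚ :- (α :+ t)) refl α γ t)
    (+-nonneg (p≤q⇒0≤q-p γ≤[1-α]/2) (+-nonneg (p≤q⇒0≤q-p (∣p∣≤q⇒p≤q ∣t∣≤γ)) (ℚP.≤-trans (ℚP.≤-trans (ℚP.0≤∣p∣ t) ∣t∣≤γ) γ≤[1-α]/2)))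

regroup : ∀ {n} (α t s : ℚ) → (α + t) * s ≡ 1ℚ → (x q e : Pt n) →
  (α *s x +v (1ℚ - α) *s q) +v e ≡ (α + t) *s (x +v s *s (e -v t *s (x -v q))) +v (1ℚ - (α + t)) *s q
regroup α t s βs≡1 [] [] [] = refl
regroup α t s βs≡1 (x ∷ xs) (q ∷ qs) (e ∷ es) = cong₂ _∷_ (sym (begin
  (α + t) * (x + s * (e - t * (x - q))) + (1ℚ - (α + t)) * q
    ≡⟨ solve 6 (λ α t s x q e → (α :+ t) :* (x :+ s :* (e :- t :* (x :- q))) :+ (con 1ℚ :- (α :+ t)) :* q
                              := (α :+ t) :* x :+ ((α :+ t) :* s) :* (e :- t :* (x :- q)) :+ (con 1ℚ :- (α :+ t)) :* q) refl α t s x q e ⟩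
  (α + t) * x + ((α + t) * s) * (e - t * (x - q)) + (1ℚ - (α + t)) * q
    ≡⟨ cong (λ k → (α + t) * x + k * (e - t * (x - q)) + (1ℚ - (α + t)) * q) βs≡1 ⟩
  (α + t) * x + 1ℚ * (e - t * (x - q)) + (1ℚ - (α + t)) * q
    ≡⟨ solve 5 (λ α t x q e → (α :+ t) :* x :+ con 1ℚ :* (e :- t :* (x :- q)) :+ (con 1ℚ :- (α :+ t)) :* q
                            := (α :* x :+ (con 1ℚ :- α) :* q) :+ e) refl α t x q e ⟩
  (α * x + (1ℚ - α) * q) + e ∎))
  (regroup α t s βs≡1 xs qs es)
  where open ≡-Reasoning

module FacetNeighbourhood {d : ℕ} {P : PtSet (suc d)} (P-convex : Convex P) (a : Pt (suc d)) (c : ℚ)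
  (u : Pt (suc d)) (u≡1-on-F : ∀ p → Face P a c p → u · p ≡ 1ℚ)
  {x : Pt (suc d)} (x∈relint : RelInterior (Face P a c) x) (dim-F : DimAtLeast (Face P a c) d) where

  F : PtSet (suc d)
  F = Face P a c

  x∈F = proj₁ x∈relint
  εF = proj₁ (proj₂ x∈relint)
  εF>0 = proj₁ (proj₂ (proj₂ x∈relint))

  u·x≡1 : u · x ≡ 1ℚ
  u·x≡1 = u≡1-on-F x x∈F

  open FacetHyperplane F u u≡1-on-F x∈F dim-F using (u⊥⊆aff)

  F-neighbourhood : ∀ f → Small εF f → u · f ≡ 0ℚ → F (x +v f)
  F-neighbourhood f f-small u·f≡0 = proj₂ (proj₂ (proj₂ x∈relint)) f f-small (u⊥⊆aff f u·f≡0)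

  -- x + s (x - p) lies in u = 1 near x, hence in F; together with a · x = c this forces a · p = c.
  u≡1⇒∈F : ∀ p → P p → u · p ≡ 1ℚ → F p
  u≡1⇒∈F p p∈P u·p≡1 = p∈P , (begin
      a · p                 ≡⟨ solve 2 (λ c q → q := c :- (c :- q)) refl c (a · p) ⟩
      c - (c - a · p)       ≡⟨ cong (λ r → c - r) (*-cancelˡ-≡0 s (c - a · p) (ℚP.<⇒≢ s>0 ∘ sym) s[c-a·p]≡0) ⟩
      c - 0ℚ                ≡⟨ solve 1 (λ c → c :- con 0ℚ := c) refl c ⟩
      c                     ∎)
    where
    open ≡-Reasoning
    S = positive-multiple-below εF>0 (‖‖₁-nonneg (x -v p))
    s = proj₁ S
    s>0 = proj₁ (proj₂ S)
    g = s *s (x -v p)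
    g-small : Small εF g
    g-small = Small-mono (proj₂ (proj₂ S)) (Small-*s (x -v p) (ℚP.<⇒≤ s>0) (Small-‖‖₁ (x -v p)))
    u·g≡0 : u · g ≡ 0ℚ
    u·g≡0 = trans (·-*s u _ s) (trans (cong (s *_) (trans (·-distrib--v u x p) (cong₂ _-_ u·x≡1 u·p≡1)))
              (solve 1 (λ s → s :* (con 1ℚ :- con 1ℚ) := con 0ℚ) refl s))
    a·x≡c = proj₂ x∈F
    s[c-a·p]≡0 : s * (c - a · p) ≡ 0ℚ
    s[c-a·p]≡0 = begin
      s * (c - a · p)             ≡⟨ solve 2 (λ c y → y := (c :+ y) :- c) refl c (s * (c - a · p)) ⟩
      (c + s * (c - a · p)) - c   ≡⟨ cong (λ r → (r + s * (r - a · p)) - r) (sym a·x≡c) ⟩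
      (a · x + s * (a · x - a · p)) - a · x
        ≡⟨ cong (λ r → (a · x + s * r) - a · x) (sym (·-distrib--v a x p)) ⟩
      (a · x + s * (a · (x -v p))) - a · x ≡⟨ cong (λ r → (a · x + r) - a · x) (sym (·-*s a _ s)) ⟩
      (a · x + a · g) - a · x     ≡⟨ cong (_- a · x) (sym (·-distrib-+v a x g)) ⟩
      a · (x +v g) - a · x        ≡⟨ cong₂ _-_ (proj₂ (F-neighbourhood g g-small u·g≡0)) a·x≡c ⟩
      c - c                       ≡⟨ ℚP.+-inverseʳ c ⟩
      0ℚ                          ∎

  -- With f = e - t (x - q) and β = α + t, the point (αx + (1-α)q) + e is β (x + f / β) + (1 - β) q.
  tilted-perturbation∈P : ∀ α t {q e} → P q → 0ℚ < α + t → 0ℚ ≤ 1ℚ - (α + t) →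
    Small ((α + t) * εF) (e -v t *s (x -v q)) → u · (e -v t *s (x -v q)) ≡ 0ℚ →
    P ((α *s x +v (1ℚ - α) *s q) +v e)
  tilted-perturbation∈P α t {q} {e} q∈P β>0 1-β≥0 f-small u·f≡0 =
    subst P (sym (regroup α t (1/ β) (ℚP.*-inverseʳ β) x q e))
      (P-convex β (1ℚ - β) (ℚP.<⇒≤ β>0) 1-β≥0 (solve 1 (λ b → b :+ (con 1ℚ :- b) := con 1ℚ) refl β)
        (proj₁ (F-neighbourhood ((1/ β) *s f) f/β-small u·f/β≡0)) q∈P)
    where
    β = α + t
    instance
      β≢0 : ℚ.NonZero β
      β≢0 = ℚ.>-nonZero β>0
    f = e -v t *s (x -v q)
    f/β-small : Small εF ((1/ β) *s f)
    f/β-small = subst (λ r → Small r ((1/ β) *s f))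
      (trans (sym (ℚP.*-assoc (1/ β) β εF)) (trans (cong (_* εF) (ℚP.*-inverseˡ β)) (ℚP.*-identityˡ εF)))
      (Small-*s f (ℚP.<⇒≤ (1/-pos β>0)) f-small)
    u·f/β≡0 : u · ((1/ β) *s f) ≡ 0ℚ
    u·f/β≡0 = trans (·-*s u f (1/ β)) (trans (cong (1/ β *_) u·f≡0) (ℚP.*-zeroʳ (1/ β)))

  tilt-in-u⊥ : ∀ q e s → s * (1ℚ - u · q) ≡ 1ℚ → u · (e -v ((u · e) * s) *s (x -v q)) ≡ 0ℚ
  tilt-in-u⊥ q e s s[1-u·q]≡1 = begin
    u · (e -v t *s (x -v q))                 ≡⟨ ·-distrib--v u e _ ⟩
    u · e - u · (t *s (x -v q))              ≡⟨ cong (λ r → u · e - r) (trans (·-*s u _ t) (cong (t *_) (·-distrib--v u x q))) ⟩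
    u · e - t * (u · x - u · q)              ≡⟨ cong (λ r → u · e - t * (r - u · q)) u·x≡1 ⟩
    u · e - ((u · e) * s) * (1ℚ - u · q)     ≡⟨ solve 3 (λ a s d → a :- (a :* s) :* d := a :- a :* (s :* d)) refl (u · e) s (1ℚ - u · q) ⟩
    u · e - (u · e) * (s * (1ℚ - u · q))     ≡⟨ cong (λ r → u · e - (u · e) * r) s[1-u·q]≡1 ⟩
    u · e - (u · e) * 1ℚ                     ≡⟨ solve 1 (λ a → a :- a :* con 1ℚ := con 0ℚ) refl (u · e) ⟩
    0ℚ                                       ∎
    where
    open ≡-Reasoning
    t = (u · e) * s

  -- The tilt t = u·e / (1 - u·q) is linear in e, hence small together with e.
  segment-interior : ∀ α → 0ℚ < α → α < 1ℚ → ∀ q → P q → u · q < 1ℚ → Interior P (α *s x +v (1ℚ - α) *s q)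
  segment-interior α α>0 α<1 q q∈P u·q<1 = ε , ε>0 , λ e e-small →
    tilted-perturbation∈P α (t e) q∈P (β>0 e e-small) (proj₂ (β-bounds e e-small)) (f-small e e-small)
      (tilt-in-u⊥ q e (1/ η) (ℚP.*-inverseˡ η))
    where
    η = 1ℚ - u · q
    η>0 = p<q⇒0<q-p u·q<1
    instance
      η≢0 : ℚ.NonZero η
      η≢0 = ℚ.>-nonZero η>0
    1/η≥0 = ℚP.<⇒≤ (1/-pos η>0)
    A = ‖ u ‖₁ * 1/ η
    B = ‖ x -v q ‖₁
    α/2>0 : 0ℚ < ½ * α
    α/2>0 = *-pos (ℚP.positive⁻¹ ½) α>0
    γ = (½ * α) ⊓ (½ * (1ℚ - α))
    m = γ ⊓ ((½ * α) * εF)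
    bounds = ε-for-linear-bounds {m} {A} {B}
      (⊓-pos (⊓-pos α/2>0 (*-pos (ℚP.positive⁻¹ ½) (p<q⇒0<q-p α<1))) (*-pos α/2>0 εF>0))
      (*-nonneg (‖‖₁-nonneg u) 1/η≥0) (‖‖₁-nonneg (x -v q))
    ε : ℚ
    ε = proj₁ bounds
    ε>0 : 0ℚ < ε
    ε>0 = proj₁ (proj₂ bounds)
    t : Pt (suc d) → ℚ
    t e = (u · e) * 1/ η
    ∣t∣≤Aε : ∀ e → Small ε e → ∣ t e ∣ ≤ A * ε
    ∣t∣≤Aε e e-small = begin
      ∣ t e ∣                   ≡⟨ trans (ℚP.∣p*q∣≡∣p∣*∣q∣ (u · e) (1/ η)) (cong (∣ u · e ∣ *_) (ℚP.0≤p⇒∣p∣≡p 1/η≥0)) ⟩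
      ∣ u · e ∣ * 1/ η           ≤⟨ *-monoʳ-≤-nonneg (·-bound ε u e e-small) 1/η≥0 ⟩
      (‖ u ‖₁ * ε) * 1/ η        ≡⟨ solve 3 (λ n e i → (n :* e) :* i := (n :* i) :* e) refl ‖ u ‖₁ ε (1/ η) ⟩
      A * ε                     ∎
      where open ℚP.≤-Reasoning
    β-bounds : ∀ e → Small ε e → (½ * α ≤ α + t e) × (0ℚ ≤ 1ℚ - (α + t e))
    β-bounds e e-small = tilted-weight-bounds {α} {t e} {γ}
      (ℚP.≤-trans (∣t∣≤Aε e e-small) (ℚP.≤-trans (proj₁ (proj₂ (proj₂ bounds))) (ℚP.p⊓q≤p γ _)))
      (ℚP.p⊓q≤p (½ * α) (½ * (1ℚ - α))) (ℚP.p⊓q≤q (½ * α) (½ * (1ℚ - α)))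
    β>0 : ∀ e → Small ε e → 0ℚ < α + t e
    β>0 e e-small = ℚP.<-≤-trans α/2>0 (proj₁ (β-bounds e e-small))
    f-small : ∀ e → Small ε e → Small ((α + t e) * εF) (e -v t e *s (x -v q))
    f-small e e-small = Small-mono
      (ℚP.≤-trans (proj₂ (proj₂ (proj₂ bounds)))
        (ℚP.≤-trans (ℚP.p⊓q≤q γ ((½ * α) * εF)) (*-monoʳ-≤-nonneg (proj₁ (β-bounds e e-small)) (ℚP.<⇒≤ εF>0))))
      (Small--v*s e (x -v q) e-small (∣t∣≤Aε e e-small))

-- Lattice points and residues

/1-mkℚ : ∀ i → i ℚ./ 1 ≡ mkℚ i 0 (Coprimality.sym (Coprimality.1-coprimeTo ℤ.∣ i ∣))
/1-mkℚ (ℤ.+ n)    = ℚP.normalize-coprime (Coprimality.sym (Coprimality.1-coprimeTo n))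
/1-mkℚ -[1+ n ] = cong ℚ.-_ (ℚP.normalize-coprime (Coprimality.sym (Coprimality.1-coprimeTo (suc n))))

/1-homo-+ : ∀ i j → (i ℤ.+ j) ℚ./ 1 ≡ i ℚ./ 1 ℚ.+ j ℚ./ 1
/1-homo-+ i j rewrite /1-mkℚ i | /1-mkℚ j =
  cong (ℚ._/ 1) (cong₂ ℤ._+_ (sym (ℤP.*-identityʳ i)) (sym (ℤP.*-identityʳ j)))

/1-homo-* : ∀ i j → (i ℤ.* j) ℚ./ 1 ≡ (i ℚ./ 1) ℚ.* (j ℚ./ 1)
/1-homo-* i j rewrite /1-mkℚ i | /1-mkℚ j = refl

/1-homo-neg : ∀ i → (ℤ.- i) ℚ./ 1 ≡ ℚ.- (i ℚ./ 1)
/1-homo-neg (ℤ.+ zero)  = refl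
/1-homo-neg (ℤ.+ suc n) rewrite /1-mkℚ (ℤ.+ suc n) = refl
/1-homo-neg -[1+ n ]  rewrite /1-mkℚ (ℤ.+ suc n) = refl

infixr 25 _*z_
_*z_ : ∀ {d} → ℤ → ZPt d → ZPt d
k *z v = map (k ℤ.*_) v

emb-+z : ∀ {d} (a b : ZPt d) → emb (a +z b) ≡ emb a +v emb b
emb-+z []      []      = refl
emb-+z (x ∷ a) (y ∷ b) = cong₂ _∷_ (/1-homo-+ x y) (emb-+z a b)

emb-negz : ∀ {d} (a : ZPt d) → emb (negz a) ≡ negv (emb a)
emb-negz []      = refl
emb-negz (x ∷ a) = cong₂ _∷_ (/1-homo-neg x) (emb-negz a)

emb-*z : ∀ {d} (k : ℤ) (a : ZPt d) → emb (k *z a) ≡ (k ℚ./ 1) *s emb a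
emb-*z k []      = refl
emb-*z k (x ∷ a) = cong₂ _∷_ (/1-homo-* k x) (emb-*z k a)

emb-+z-*z : ∀ {d} (k : ℤ) (a v : ZPt d) → emb (a +z k *z v) ≡ emb a +v (k ℚ./ 1) *s emb v
emb-+z-*z k a v = trans (emb-+z a _) (cong (emb a +v_) (emb-*z k v))

+z-*z-0z : ∀ {d} (k : ℤ) (a : ZPt d) → a +z k *z 0z ≡ a
+z-*z-0z k []      = refl
+z-*z-0z k (y ∷ a) = cong₂ _∷_ (trans (cong (λ r → y ℤ.+ r) (ℤP.*-zeroʳ k)) (ℤP.+-identityʳ y)) (+z-*z-0z k a)

negz-involutive : ∀ {d} (a : ZPt d) → negz (negz a) ≡ a
negz-involutive []      = refl
negz-involutive (y ∷ a) = cong₂ _∷_ (ℤP.neg-involutive y) (negz-involutive a)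

+z-cancelˡ : ∀ {d} (x a b : ZPt d) → x +z a ≡ x +z b → a ≡ b
+z-cancelˡ []      []      []      _ = refl
+z-cancelˡ (y ∷ x) (p ∷ a) (q ∷ b) eq =
  cong₂ _∷_ (cancel (cong head eq)) (+z-cancelˡ x a b (cong tail eq))
  where
  cancel : y ℤ.+ p ≡ y ℤ.+ q → p ≡ q
  cancel y+p≡y+q = begin
    p                    ≡⟨ -y+[y+p]≡p y p ⟨
    ℤ.- y ℤ.+ (y ℤ.+ p)  ≡⟨ cong (λ r → ℤ.- y ℤ.+ r) y+p≡y+q ⟩
    ℤ.- y ℤ.+ (y ℤ.+ q)  ≡⟨ -y+[y+p]≡p y q ⟩
    q                    ∎
    where
    open ≡-Reasoning
    -y+[y+p]≡p : ∀ y p → ℤ.- y ℤ.+ (y ℤ.+ p) ≡ p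
    -y+[y+p]≡p = solve-∀

x+-[x+-w]≡w : ∀ {d} (x w : ZPt d) → x +z negz (x +z negz w) ≡ w
x+-[x+-w]≡w []      []      = refl
x+-[x+-w]≡w (p ∷ x) (q ∷ w) =
  cong₂ _∷_ (p-[p-q]≡q p q) (x+-[x+-w]≡w x w)
  where
  p-[p-q]≡q : ∀ p q → p ℤ.+ ℤ.- (p ℤ.+ ℤ.- q) ≡ q
  p-[p-q]≡q = solve-∀

module Residues (k : ℕ) .{{_ : ℕ.NonZero k}} where

  residue : ℤ → Fin k
  residue a = fromℕ< (ℤD.n%ℕd<d a k)

  residues : ∀ {d} → ZPt d → Fin (k ^ d)
  residues []       = zero
  residues (a ∷ as) = combine (residue a) (residues as)

  same-residue⇒congruent : ∀ a b → residue a ≡ residue b → a ≡ b ℤ.+ ℤ.+ k ℤ.* (a /ℕ k ℤ.- b /ℕ k)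
  same-residue⇒congruent a b same = begin
    a                                                     ≡⟨ ℤD.a≡a%ℕn+[a/ℕn]*n a k ⟩
    ℤ.+ (a %ℕ k) ℤ.+ (a /ℕ k) ℤ.* ℤ.+ k                       ≡⟨ cong (λ r → ℤ.+ r ℤ.+ (a /ℕ k) ℤ.* ℤ.+ k) a%k≡b%k ⟩
    ℤ.+ (b %ℕ k) ℤ.+ (a /ℕ k) ℤ.* ℤ.+ k                       ≡⟨ shift-quotient (ℤ.+ (b %ℕ k)) (a /ℕ k) (b /ℕ k) (ℤ.+ k) ⟩
    (ℤ.+ (b %ℕ k) ℤ.+ (b /ℕ k) ℤ.* ℤ.+ k) ℤ.+ ℤ.+ k ℤ.* (a /ℕ k ℤ.- b /ℕ k)
                                                          ≡⟨ cong (ℤ._+ ℤ.+ k ℤ.* (a /ℕ k ℤ.- b /ℕ k)) (sym (ℤD.a≡a%ℕn+[a/ℕn]*n b k)) ⟩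
    b ℤ.+ ℤ.+ k ℤ.* (a /ℕ k ℤ.- b /ℕ k)                     ∎
    where
    open ≡-Reasoning
    shift-quotient : ∀ r qa qb k → r ℤ.+ qa ℤ.* k ≡ (r ℤ.+ qb ℤ.* k) ℤ.+ k ℤ.* (qa ℤ.- qb)
    shift-quotient = solve-∀
    a%k≡b%k : a %ℕ k ≡ b %ℕ k
    a%k≡b%k = trans (sym (FinP.toℕ-fromℕ< (ℤD.n%ℕd<d a k))) (trans (cong toℕ same) (FinP.toℕ-fromℕ< (ℤD.n%ℕd<d b k)))

  same-residues⇒congruent : ∀ {d} (a b : ZPt d) → residues a ≡ residues b → Σ (ZPt d) λ v → a ≡ b +z (ℤ.+ k) *z v
  same-residues⇒congruent []      []      _    = [] , refl
  same-residues⇒congruent {suc d} (x ∷ a) (y ∷ b) same with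
    trans (sym (FinP.remQuot-combine (residue x) (residues a)))
      (trans (cong (remQuot {k} (k ^ d)) same) (FinP.remQuot-combine (residue y) (residues b)))
  ... | same-pair with same-residues⇒congruent a b (cong proj₂ same-pair)
  ... | v , a≡b+kv = (x /ℕ k ℤ.- y /ℕ k) ∷ v , cong₂ _∷_ (same-residue⇒congruent x y (cong proj₁ same-pair)) a≡b+kv

injective⇒surjective : ∀ {m n} (f : Fin m → Fin n) → n ℕ.≤ m → Injective _≡_ _≡_ f → ∀ y → Σ (Fin m) λ i → f i ≡ y
injective⇒surjective {n = suc n} f n≤m f-injective y with FinP.any? (λ i → f i FinP.≟ y)
... | yes found = found
... | no missed = ⊥-elim (ℕP.<-irrefl refl (ℕP.≤-trans n≤m (FinP.injective⇒≤ punched-injective)))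
  where
  y≢f : ∀ i → y ≢ f i
  y≢f i y≡fi = missed (i , sym y≡fi)
  punched-injective : Injective _≡_ _≡_ (λ i → punchOut (y≢f i))
  punched-injective eq = f-injective (FinP.punchOut-injective (y≢f _) (y≢f _) eq)

lookup-injective : ∀ {A : Set} (xs : List A) → Unique xs → Injective _≡_ _≡_ (List.lookup xs)
lookup-injective (x ∷ xs) (x∉xs ∷ unique) {zero}  {zero}  eq = refl
lookup-injective (x ∷ xs) (x∉xs ∷ unique) {zero}  {suc j} eq = ⊥-elim (ListAll.lookup x∉xs (∈-lookup j) eq)
lookup-injective (x ∷ xs) (x∉xs ∷ unique) {suc i} {zero}  eq = ⊥-elim (ListAll.lookup x∉xs (∈-lookup i) (sym eq))
lookup-injective (x ∷ xs) (x∉xs ∷ unique) {suc i} {suc j} eq = cong suc (lookup-injective xs unique eq)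

-- Centrally symmetric polytopes with 3^d lattice points

3ℤ : ℤ
3ℤ = ℤ.+ 3

⅓ ⅙ ⅕ ⅘ 3ℚ : ℚ
⅓ = ℤ.+ 1 ℚ./ 3
⅙ = ℤ.+ 1 ℚ./ 6
⅕ = ℤ.+ 1 ℚ./ 5
⅘ = ℤ.+ 4 ℚ./ 5
3ℚ = 3ℤ ℚ./ 1

-1<1 : - 1ℚ < 1ℚ
-1<1 = toWitness {a? = - 1ℚ ℚP.<? 1ℚ} _

½<1 : ½ < 1ℚ
½<1 = toWitness {a? = ½ ℚP.<? 1ℚ} _

⅓<1 : ⅓ < 1ℚ
⅓<1 = toWitness {a? = ⅓ ℚP.<? 1ℚ} _

⅙<1 : ⅙ < 1ℚ
⅙<1 = toWitness {a? = ⅙ ℚP.<? 1ℚ} _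

third-of-sum : ∀ {n} (X Z P W : Pt n) → X +v Z ≡ P +v 3ℚ *s W → W ≡ ⅓ *s X +v (1ℚ - ⅓) *s (½ *s Z +v ½ *s negv P)
third-of-sum [] [] [] [] _ = refl
third-of-sum (x ∷ X) (z ∷ Z) (p ∷ P) (w ∷ W) eq = cong₂ _∷_ (sym (begin
  ⅓ * x + (1ℚ - ⅓) * (½ * z + ½ * (- p))
    ≡⟨ solve 3 (λ x z p → con ⅓ :* x :+ (con 1ℚ :- con ⅓) :* (con ½ :* z :+ con ½ :* (:- p)) := con ⅓ :* (x :+ z) :- con ⅓ :* p) refl x z p ⟩
  ⅓ * (x + z) - ⅓ * p     ≡⟨ cong (λ r → ⅓ * r - ⅓ * p) (cong head eq) ⟩
  ⅓ * (p + 3ℚ * w) - ⅓ * p ≡⟨ solve 2 (λ p w → con ⅓ :* (p :+ con 3ℚ :* w) :- con ⅓ :* p := w) refl p w ⟩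
  w                        ∎))
  (third-of-sum X Z P W (cong tail eq))
  where open ≡-Reasoning

third-of-difference : ∀ {n} (X P P′ W : Pt n) → P ≡ P′ +v 3ℚ *s W →
  W ≡ ⅙ *s X +v (1ℚ - ⅙) *s (⅕ *s negv X +v ⅘ *s (½ *s P +v ½ *s negv P′))
third-of-difference [] [] [] [] _ = refl
third-of-difference (x ∷ X) (p ∷ P) (p′ ∷ P′) (w ∷ W) eq = cong₂ _∷_ (begin
  w                             ≡⟨ solve 3 (λ x p′ w → w := con ⅙ :* x :+ (con 1ℚ :- con ⅙) :* (con ⅕ :* (:- x)
                                      :+ con ⅘ :* (con ½ :* (p′ :+ con 3ℚ :* w) :+ con ½ :* (:- p′)))) refl x p′ w ⟩
  ⅙ * x + (1ℚ - ⅙) * (⅕ * (- x) + ⅘ * (½ * (p′ + 3ℚ * w) + ½ * (- p′)))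
                                ≡⟨ cong (λ r → ⅙ * x + (1ℚ - ⅙) * (⅕ * (- x) + ⅘ * (½ * r + ½ * (- p′)))) (sym (cong head eq)) ⟩
  ⅙ * x + (1ℚ - ⅙) * (⅕ * (- x) + ⅘ * (½ * p + ½ * (- p′))) ∎)
  (third-of-difference X P P′ W (cong tail eq))
  where open ≡-Reasoning

translate-midpoint : ∀ {n} (X Y Z : Pt n) → X +v Y ≡ Z → Z ≡ ½ *s (X +v Z) +v (1ℚ - ½) *s Y
translate-midpoint [] [] [] _ = refl
translate-midpoint (x ∷ X) (y ∷ Y) (z ∷ Z) eq = cong₂ _∷_ (sym (begin
  ½ * (x + z) + (1ℚ - ½) * y ≡⟨ solve 3 (λ x y z → con ½ :* (x :+ z) :+ (con 1ℚ :- con ½) :* y := con ½ :* z :+ con ½ :* (x :+ y)) refl x y z ⟩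
  ½ * z + ½ * (x + y)        ≡⟨ cong (λ r → ½ * z + ½ * r) (cong head eq) ⟩
  ½ * z + ½ * z              ≡⟨ solve 1 (λ z → con ½ :* z :+ con ½ :* z := z) refl z ⟩
  z                          ∎))
  (translate-midpoint X Y Z (cong tail eq))
  where open ≡-Reasoning

midpoint-<1 : ∀ a b → a < 1ℚ → b ≤ 1ℚ → ½ * a + ½ * b < 1ℚ
midpoint-<1 a b a<1 b≤1 = 0<q-p⇒p<q (subst (0ℚ <_)
  (solve 2 (λ a b → con ½ :* (con 1ℚ :- a) :+ con ½ :* (con 1ℚ :- b) := con 1ℚ :- (con ½ :* a :+ con ½ :* b)) refl a b)
  (+-pos (*-pos (ℚP.positive⁻¹ ½) (p<q⇒0<q-p a<1)) (*-nonneg (ℚP.nonNegative⁻¹ ½) (p≤q⇒0≤q-p b≤1))))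

toward-opposite-<1 : ∀ a b → a ≤ 1ℚ → b ≤ 1ℚ → ⅕ * (- 1ℚ) + ⅘ * (½ * a + ½ * b) < 1ℚ
toward-opposite-<1 a b a≤1 b≤1 = 0<q-p⇒p<q (subst (0ℚ <_)
  (solve 2 (λ a b → con ⅖ :+ (con ⅖ :* (con 1ℚ :- a) :+ con ⅖ :* (con 1ℚ :- b))
                   := con 1ℚ :- (con ⅕ :* (:- con 1ℚ) :+ con ⅘ :* (con ½ :* a :+ con ½ :* b))) refl a b)
  (+-pos ⅖>0 (+-nonneg (*-nonneg (ℚP.<⇒≤ ⅖>0) (p≤q⇒0≤q-p a≤1)) (*-nonneg (ℚP.<⇒≤ ⅖>0) (p≤q⇒0≤q-p b≤1)))))
  where
  ⅖ = ℤ.+ 2 ℚ./ 5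
  ⅖>0 : 0ℚ < ⅖
  ⅖>0 = ℚP.positive⁻¹ ⅖

module CentrallySymmetricPolytope {d m : ℕ} (V : Fin m → ZPt (suc d))
  (P-symmetric : ∀ p → Conv V p → Conv V (negv p))
  (only-interior-lattice-point-is-0 : ∀ z → Interior (Conv V) (emb z) → z ≡ 0z)
  (L : List (ZPt (suc d))) (L-unique : Unique L)
  (L-enumerates-P∩ℤ : ∀ z → (z ∈ L → Conv V (emb z)) × (Conv V (emb z) → z ∈ L))
  (|L|≡3^d : length L ≡ 3 ^ suc d)
  (a : Pt (suc d)) (c : ℚ) (u : Pt (suc d))
  (u≡1-on-F : ∀ p → Face (Conv V) a c p → u · p ≡ 1ℚ) (u≤1-on-P : ∀ p → Conv V p → u · p ≤ 1ℚ)
  (x : ZPt (suc d)) (x∈relint : RelInterior (Face (Conv V) a c) (emb x))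
  (dim-F : DimAtLeast (Face (Conv V) a c) d) where

  P F : PtSet (suc d)
  P = Conv V
  F = Face P a c

  open FacetNeighbourhood (Conv-convex V) a c u u≡1-on-F x∈relint dim-F using (x∈F; u·x≡1; u≡1⇒∈F; segment-interior)
  open Residues 3 using (residues; same-residues⇒congruent)

  Pℤ Fℤ Hℤ NegFℤ : ZPt (suc d) → Set
  Pℤ z    = P (emb z)
  Fℤ z    = F (emb z)
  Hℤ z    = P (emb z) × (u · emb z ≡ 0ℚ)
  NegFℤ z = Fℤ (negz z)

  Pℤ-negz : ∀ z → Pℤ z → Pℤ (negz z)
  Pℤ-negz z z∈P = subst P (sym (emb-negz z)) (P-symmetric _ z∈P)

  u·negz : ∀ z → u · emb (negz z) ≡ - (u · emb z)
  u·negz z = trans (cong (u ·_) (emb-negz z)) (·-negv u _)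

  u·x+z : ∀ z → u · emb (x +z z) ≡ 1ℚ + u · emb z
  u·x+z z = trans (cong (u ·_) (emb-+z x z)) (trans (·-distrib-+v u (emb x) (emb z)) (cong (_+ u · emb z) u·x≡1))

  u≡-1-on-NegF : ∀ z → NegFℤ z → u · emb z ≡ - 1ℚ
  u≡-1-on-NegF z -z∈F = trans (solve 1 (λ t → t := :- (:- t)) refl (u · emb z))
    (cong -_ (trans (sym (u·negz z)) (u≡1-on-F _ -z∈F)))

  -- (p - p′)/3 = x/6 + 5q/6 with q = -x/5 + 4/5 · (p - p′)/2 ∈ P and u · q ≤ 3/5.
  congruent-in-P⇒equal : ∀ p p′ v → Pℤ p → Pℤ p′ → p ≡ p′ +z 3ℤ *z v → p ≡ p′
  congruent-in-P⇒equal p p′ v p∈P p′∈P p≡p′+3v =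
    trans p≡p′+3v (trans (cong (λ w → p′ +z 3ℤ *z w) v≡0) (+z-*z-0z 3ℤ p′))
    where
    mid = ½ *s emb p +v ½ *s negv (emb p′)
    mid∈P = Conv-convex V ½ ½ (ℚP.nonNegative⁻¹ ½) (ℚP.nonNegative⁻¹ ½) refl p∈P (P-symmetric _ p′∈P)
    q = ⅕ *s negv (emb x) +v ⅘ *s mid
    q∈P : P q
    q∈P = Conv-convex V ⅕ ⅘ (ℚP.nonNegative⁻¹ ⅕) (ℚP.nonNegative⁻¹ ⅘) refl (P-symmetric _ (proj₁ x∈F)) mid∈P
    u·q<1 : u · q < 1ℚ
    u·q<1 = subst (_< 1ℚ)
      (sym (trans (·-combination u (negv (emb x)) mid ⅕ ⅘)
        (cong₂ (λ r s → ⅕ * r + ⅘ * s) (trans (·-negv u (emb x)) (cong -_ u·x≡1)) (·-combination u (emb p) (negv (emb p′)) ½ ½))))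
      (toward-opposite-<1 (u · emb p) (u · negv (emb p′)) (u≤1-on-P _ p∈P) (u≤1-on-P _ (P-symmetric _ p′∈P)))
    v≡0 : v ≡ 0z
    v≡0 = only-interior-lattice-point-is-0 v (subst (Interior P)
      (sym (third-of-difference (emb x) (emb p) (emb p′) (emb v) (trans (cong emb p≡p′+3v) (emb-+z-*z 3ℤ p′ v))))
      (segment-interior ⅙ (ℚP.positive⁻¹ ⅙) ⅙<1 q q∈P u·q<1))

  -- The 3^d points of P ∩ ℤ^d are pairwise incongruent mod 3, so they meet every residue class.
  congruent-to-Pℤ : ∀ q → Σ (ZPt (suc d)) λ p → Pℤ p × Σ (ZPt (suc d)) λ v → q ≡ p +z 3ℤ *z v
  congruent-to-Pℤ q = List.lookup L i , L⊆P i , same-residues⇒congruent q (List.lookup L i) (sym same)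
    where
    L⊆P : ∀ i → Pℤ (List.lookup L i)
    L⊆P i = proj₁ (L-enumerates-P∩ℤ _) (∈-lookup i)
    residues-injective : ∀ {i j} → residues (List.lookup L i) ≡ residues (List.lookup L j) → i ≡ j
    residues-injective {i} {j} same = lookup-injective L L-unique
      (congruent-in-P⇒equal _ _ (proj₁ congruent) (L⊆P i) (L⊆P j) (proj₂ congruent))
      where congruent = same-residues⇒congruent (List.lookup L i) (List.lookup L j) same
    onto = injective⇒surjective (λ i → residues (List.lookup L i)) (ℕP.≤-reflexive (sym |L|≡3^d)) residues-injective (residues q)
    i = proj₁ onto
    same = proj₂ onto

  -- (x + z - p)/3 lies strictly between x and the midpoint of z and -p.
  congruent-to-x+z⇒equal : ∀ z p v → Pℤ z → u · emb z < 1ℚ → Pℤ p → x +z z ≡ p +z 3ℤ *z v → x +z z ≡ p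
  congruent-to-x+z⇒equal z p v z∈P u·z<1 p∈P x+z≡p+3v =
    trans x+z≡p+3v (trans (cong (λ w → p +z 3ℤ *z w) v≡0) (+z-*z-0z 3ℤ p))
    where
    mid = ½ *s emb z +v ½ *s negv (emb p)
    mid∈P = Conv-convex V ½ ½ (ℚP.nonNegative⁻¹ ½) (ℚP.nonNegative⁻¹ ½) refl z∈P (P-symmetric _ p∈P)
    u·mid<1 : u · mid < 1ℚ
    u·mid<1 = subst (_< 1ℚ) (sym (·-combination u (emb z) (negv (emb p)) ½ ½))
      (midpoint-<1 (u · emb z) (u · negv (emb p)) u·z<1 (u≤1-on-P _ (P-symmetric _ p∈P)))
    emb-x+z≡ : emb x +v emb z ≡ emb p +v 3ℚ *s emb v
    emb-x+z≡ = trans (sym (emb-+z x z)) (trans (cong emb x+z≡p+3v) (emb-+z-*z 3ℤ p v))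
    v≡0 : v ≡ 0z
    v≡0 = only-interior-lattice-point-is-0 v (subst (Interior P) (sym (third-of-sum (emb x) (emb z) (emb p) (emb v) emb-x+z≡))
      (segment-interior ⅓ (ℚP.positive⁻¹ ⅓) ⅓<1 mid mid∈P u·mid<1))

  translate-by-x : ∀ z → Pℤ z → u · emb z < 1ℚ → Pℤ (x +z z)
  translate-by-x z z∈P u·z<1 = subst Pℤ (sym (congruent-to-x+z⇒equal z p v z∈P u·z<1 p∈P x+z≡p+3v)) p∈P
    where
    p = proj₁ (congruent-to-Pℤ (x +z z))
    p∈P = proj₁ (proj₂ (congruent-to-Pℤ (x +z z)))
    v = proj₁ (proj₂ (proj₂ (congruent-to-Pℤ (x +z z))))
    x+z≡p+3v = proj₂ (proj₂ (proj₂ (congruent-to-Pℤ (x +z z))))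

  u≤0-below-F : ∀ z → Pℤ z → u · emb z < 1ℚ → u · emb z ≤ 0ℚ
  u≤0-below-F z z∈P u·z<1 = 0≤q-p⇒p≤q (subst (0ℚ ≤_) (solve 1 (λ t → con 1ℚ :- (con 1ℚ :+ t) := con 0ℚ :- t) refl (u · emb z))
    (p≤q⇒0≤q-p (subst (_≤ 1ℚ) (u·x+z z) (u≤1-on-P _ (translate-by-x z z∈P u·z<1)))))

  u-levels : ∀ z → Pℤ z → (u · emb z ≡ 1ℚ) ⊎ (u · emb z ≡ 0ℚ) ⊎ (u · emb (negz z) ≡ 1ℚ)
  u-levels z z∈P = by-cases (u · emb z ℚP.≟ 1ℚ) (u · emb (negz z) ℚP.≟ 1ℚ)
    where
    <1 : ∀ {w} → Pℤ w → u · emb w ≢ 1ℚ → u · emb w < 1ℚ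
    <1 w∈P u·w≢1 = ≤∧≢⇒< (u≤1-on-P _ w∈P) u·w≢1
    by-cases : Dec (u · emb z ≡ 1ℚ) → Dec (u · emb (negz z) ≡ 1ℚ) →
      (u · emb z ≡ 1ℚ) ⊎ (u · emb z ≡ 0ℚ) ⊎ (u · emb (negz z) ≡ 1ℚ)
    by-cases (yes u·z≡1) _                = inj₁ u·z≡1
    by-cases (no u·z≢1)  (yes u·-z≡1)     = inj₂ (inj₂ u·-z≡1)
    by-cases (no u·z≢1)  (no u·-z≢1)      = inj₂ (inj₁ (ℚP.≤-antisym (u≤0-below-F z z∈P (<1 z∈P u·z≢1))
      (subst (0ℚ ≤_) (solve 1 (λ t → con 0ℚ :- (:- t) := t) refl (u · emb z))
        (p≤q⇒0≤q-p (subst (_≤ 0ℚ) (u·negz z) (u≤0-below-F (negz z) (Pℤ-negz z z∈P) (<1 (Pℤ-negz z z∈P) u·-z≢1)))))))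

  partition : ∀ z → Pℤ z → Fℤ z ⊎ Hℤ z ⊎ NegFℤ z
  partition z z∈P with u-levels z z∈P
  ... | inj₁ u·z≡1          = inj₁ (u≡1⇒∈F _ z∈P u·z≡1)
  ... | inj₂ (inj₁ u·z≡0)   = inj₂ (inj₁ (z∈P , u·z≡0))
  ... | inj₂ (inj₂ u·-z≡1)  = inj₂ (inj₂ (u≡1⇒∈F _ (Pℤ-negz z z∈P) u·-z≡1))

  parts⊆Pℤ : ∀ z → Fℤ z ⊎ Hℤ z ⊎ NegFℤ z → Pℤ z
  parts⊆Pℤ z (inj₁ z∈F)          = proj₁ z∈F
  parts⊆Pℤ z (inj₂ (inj₁ z∈H))   = proj₁ z∈H
  parts⊆Pℤ z (inj₂ (inj₂ -z∈F))  = subst Pℤ (negz-involutive z) (Pℤ-negz _ (proj₁ -z∈F))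

  F∩H=∅ : ∀ z → ¬ (Fℤ z × Hℤ z)
  F∩H=∅ z (z∈F , z∈H) = ℚP.1≢0 (trans (sym (u≡1-on-F _ z∈F)) (proj₂ z∈H))

  F∩-F=∅ : ∀ z → ¬ (Fℤ z × NegFℤ z)
  F∩-F=∅ z (z∈F , -z∈F) = ℚP.<⇒≢ -1<1 (trans (sym (u≡-1-on-NegF z -z∈F)) (u≡1-on-F _ z∈F))

  H∩-F=∅ : ∀ z → ¬ (Hℤ z × NegFℤ z)
  H∩-F=∅ z (z∈H , -z∈F) = ℚP.1≢0 (trans (sym (u≡1-on-F _ -z∈F)) (trans (u·negz z) (cong -_ (proj₂ z∈H))))

  -F→H : ∀ y → NegFℤ y → Hℤ (x +z y)
  -F→H y -y∈F = translate-by-x y (parts⊆Pℤ y (inj₂ (inj₂ -y∈F))) (subst (_< 1ℚ) (sym u·y≡-1) -1<1) ,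
    trans (u·x+z y) (trans (cong (λ r → 1ℚ + r) u·y≡-1) (ℚP.+-inverseʳ 1ℚ))
    where u·y≡-1 = u≡-1-on-NegF y -y∈F

  H→F : ∀ y → Hℤ y → Fℤ (x +z y)
  H→F y (y∈P , u·y≡0) = u≡1⇒∈F _ (translate-by-x y y∈P (subst (_< 1ℚ) (sym u·y≡0) (ℚP.positive⁻¹ 1ℚ)))
    (trans (u·x+z y) (trans (cong (λ r → 1ℚ + r) u·y≡0) (ℚP.+-identityʳ 1ℚ)))

  x-w∈P : ∀ w → Pℤ w → - (u · emb w) < 1ℚ → Pℤ (x +z negz w)
  x-w∈P w w∈P -u·w<1 = translate-by-x (negz w) (Pℤ-negz w w∈P) (subst (_< 1ℚ) (sym (u·negz w)) -u·w<1)

  H→-F-onto : ∀ w → Hℤ w → Σ (ZPt (suc d)) λ y → NegFℤ y × (x +z y ≡ w)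
  H→-F-onto w (w∈P , u·w≡0) = negz (x +z negz w) , subst Fℤ (sym (negz-involutive _)) x-w∈F , x+-[x+-w]≡w x w
    where
    -u·w≡0 : - (u · emb w) ≡ 0ℚ
    -u·w≡0 = cong -_ u·w≡0
    x-w∈F : Fℤ (x +z negz w)
    x-w∈F = u≡1⇒∈F _ (x-w∈P w w∈P (subst (_< 1ℚ) (sym -u·w≡0) (ℚP.positive⁻¹ 1ℚ)))
      (trans (u·x+z (negz w)) (trans (cong (λ r → 1ℚ + r) (trans (u·negz w) -u·w≡0)) (ℚP.+-identityʳ 1ℚ)))

  F→H-onto : ∀ w → Fℤ w → Σ (ZPt (suc d)) λ y → Hℤ y × (x +z y ≡ w)
  F→H-onto w w∈F = negz (x +z negz w) , (Pℤ-negz _ x-w∈P′ , trans (u·negz _) (cong -_ u·[x-w]≡0)) , x+-[x+-w]≡w x w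
    where
    -u·w≡-1 : - (u · emb w) ≡ - 1ℚ
    -u·w≡-1 = cong -_ (u≡1-on-F _ w∈F)
    x-w∈P′ : Pℤ (x +z negz w)
    x-w∈P′ = x-w∈P w (proj₁ w∈F) (subst (_< 1ℚ) (sym -u·w≡-1) -1<1)
    u·[x-w]≡0 : u · emb (x +z negz w) ≡ 0ℚ
    u·[x-w]≡0 = trans (u·x+z (negz w)) (trans (cong (λ r → 1ℚ + r) (trans (u·negz w) -u·w≡-1)) (ℚP.+-inverseʳ 1ℚ))

  -- z = ½ (x + z) + ½ (z - x) with both ends in P, while u separates them when u · z = 0.
  vertex∈F∪-F : ∀ p → IsVertex P p → Σ (ZPt (suc d)) λ z → (emb z ≡ p) × (Fℤ z ⊎ NegFℤ z)
  vertex∈F∪-F p p-vertex = V i , sym p≡Vᵢ , not-in-H (partition (V i) (Generators.generator∈Conv V i))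
    where
    i = proj₁ (Generators.vertex-is-generator V p p-vertex)
    p≡Vᵢ = proj₂ (Generators.vertex-is-generator V p p-vertex)
    not-in-H : Fℤ (V i) ⊎ Hℤ (V i) ⊎ NegFℤ (V i) → Fℤ (V i) ⊎ NegFℤ (V i)
    not-in-H (inj₁ z∈F)         = inj₁ z∈F
    not-in-H (inj₂ (inj₂ -z∈F)) = inj₂ -z∈F
    not-in-H (inj₂ (inj₁ z∈H))  = ⊥-elim (ℚP.<⇒≢ -1<1 (begin
      - 1ℚ                              ≡⟨ sym (u≡-1-on-NegF y (proj₁ (proj₂ (H→-F-onto z z∈H)))) ⟩
      u · emb y                         ≡⟨ cong (u ·_) (sym x+z≡y) ⟩
      u · emb (x +z z)                  ≡⟨ u≡1-on-F _ (H→F z z∈H) ⟩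
      1ℚ                                ∎))
      where
      open ≡-Reasoning
      z = V i
      y = proj₁ (H→-F-onto z z∈H)
      midpoint : p ≡ ½ *s emb (x +z z) +v (1ℚ - ½) *s emb y
      midpoint = trans p≡Vᵢ (trans (translate-midpoint (emb x) (emb y) (emb z)
        (trans (sym (emb-+z x y)) (cong emb (proj₂ (proj₂ (H→-F-onto z z∈H))))))
        (cong (λ r → ½ *s r +v (1ℚ - ½) *s emb y) (sym (emb-+z x z))))
      x+z≡y : emb (x +z z) ≡ emb y
      x+z≡y = proj₂ p-vertex _ _ ½ (proj₁ (H→F z z∈H)) (parts⊆Pℤ y (inj₂ (inj₂ (proj₁ (proj₂ (H→-F-onto z z∈H))))))
        (ℚP.positive⁻¹ ½) ½<1 midpoint

corollary4p6 :
    (d : ℕ) → 2 ℕ.≤ d →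
    (m : ℕ) (V : Fin m → ZPt d) →
    HasDim (Conv V) d →
    (∀ p → Conv V p → Conv V (negv p)) →
    (∀ z → Interior (Conv V) (emb z) → z ≡ 0z) →
    (Σ (List (ZPt d)) λ L → Unique L ×
        (∀ z → (z ∈ L → Conv V (emb z)) × (Conv V (emb z) → z ∈ L)) ×
        (length L ≡ 3 ^ d)) →
    (a : Pt d) (c : ℚ) → IsFacet (Conv V) a c →
    (u : Pt d) →
    (∀ p → Face (Conv V) a c p → u · p ≡ 1ℚ) →
    (∀ p → Conv V p → u · p ℚ.≤ 1ℚ) →
    (x : ZPt d) → RelInterior (Face (Conv V) a c) (emb x) →
    let PZ : ZPt d → Set
        PZ z = Conv V (emb z)
        FZ : ZPt d → Set
        FZ z = Face (Conv V) a c (emb z)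
        HZ : ZPt d → Set
        HZ z = Conv V (emb z) × (u · emb z ≡ 0ℚ)
        NFZ : ZPt d → Set
        NFZ z = FZ (negz z)
    in
    ((∀ z → PZ z → FZ z ⊎ HZ z ⊎ NFZ z) ×
     (∀ z → FZ z ⊎ HZ z ⊎ NFZ z → PZ z) ×
     (∀ z → ¬ (FZ z × HZ z)) ×
     (∀ z → ¬ (FZ z × NFZ z)) ×
     (∀ z → ¬ (HZ z × NFZ z))) ×
    ((∀ y → NFZ y → HZ (x +z y)) ×
     (∀ y y′ → NFZ y → NFZ y′ → x +z y ≡ x +z y′ → y ≡ y′) ×
     (∀ w → HZ w → Σ (ZPt d) λ y → NFZ y × (x +z y ≡ w))) ×
    ((∀ y → HZ y → FZ (x +z y)) ×
     (∀ y y′ → HZ y → HZ y′ → x +z y ≡ x +z y′ → y ≡ y′) ×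
     (∀ w → FZ w → Σ (ZPt d) λ y → HZ y × (x +z y ≡ w))) ×
    (∀ p → IsVertex (Conv V) p → Σ (ZPt d) λ z → (emb z ≡ p) × (FZ z ⊎ NFZ z))
corollary4p6 (suc d) (s≤s _) m V _ P-symmetric only-interior-lattice-point-is-0 (L , L-unique , L-enumerates-P∩ℤ , |L|≡3^d)
  a c (_ , dim-F , _) u u≡1-on-F u≤1-on-P x x∈relint =
  (partition , parts⊆Pℤ , F∩H=∅ , F∩-F=∅ , H∩-F=∅) ,
  (-F→H , (λ y y′ _ _ → +z-cancelˡ x y y′) , H→-F-onto) ,
  (H→F , (λ y y′ _ _ → +z-cancelˡ x y y′) , F→H-onto) ,
  vertex∈F∪-F
  where
  open CentrallySymmetricPolytope V P-symmetric only-interior-lattice-point-is-0 L L-unique L-enumerates-P∩ℤ |L|≡3^d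
    a c u u≡1-on-F u≤1-on-P x x∈relint dim-F
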